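{- Let $n \geq 2$ and let $v_1, \dots, v_{2^{n-1}} \in \mathbb{F}_2^n$ be nonzero vectors such that $v_{2i-1} = v_{2i}$ for all $1 \leq i \leq 2^{n-2}$, and such that there are exactly $n$ distinct vectors among the $v_i$. Then there exist vectors $p_1, q_1, \dots, p_{2^{n-1}}, q_{2^{n-1}}$ forming exactly the $2^n$ elements of $\mathbb{F}_2^n$ (each once) with $p_i + q_i = v_i$ for all $1 \leq i \leq 2^{n-1}$. -}

module Defs where

open import Data.Bool using (Bool; false; _xor_)
open import Data.Vec using (Vec; zipWith; replicate)
open import Data.Nat using (ℕ)

F₂^ : ℕ → Set
F₂^ n = Vec Bool n

_⊕_ : ∀ {n} → F₂^ n → F₂^ n → F₂^ n
_⊕_ = zipWith _xor_

𝟎 : ∀ {n} → F₂^ n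
𝟎 = replicate _ false

module Submission where

-- Lemma 10 (pairing F₂^n by prescribed differences), via a stronger statement on multisets.
-- A multiset of labels is d : F₂^n → ℕ, with slots (x , i) for i < d x; a pairing for d is a
-- bijection e : Slots d × Bool × Bool ≅ F₂^n with e (p , b , true) = e (p , b , false) ⊕ label p:
-- every slot owns two pairs {u , u ⊕ x}, and all these pairs partition F₂^n.  If n = k + 2, d 0 = 0, |d| = 2^k and at most n labels occur,
--   then d has a pairing.  Let t have maximal multiplicity M.
--  * If at most M other labels have odd multiplicity, quotient by ⟨t⟩: the other labels,
--    projected, halved (rounding up) and padded, have a pairing of F₂^(n-1) by induction,
--    which lifts back with the copies of t filling the gaps.
--  * Otherwise counting leaves two exceptions: n = 4 with four distinct labels (direct), and
--    n = 6 with multiplicities ≤ 4, reduced instead by a plane ⟨t , t'⟩ through a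
--    machine-checked pairing lemma in F₂^3.
-- Lemma 10 is the case where d counts the labels v_{2i}.

open import Defs
open import Data.Bool using (Bool; false; true; T; not; _∧_; _∨_; _xor_; if_then_else_)
  renaming (_≟_ to _≟ᵇ_)
open import Data.Bool.Properties
  using (xor-assoc; xor-comm; xor-identityʳ; xor-same)
open import Data.Empty using (⊥; ⊥-elim)
open import Data.Fin using (Fin; zero; suc; toℕ; splitAt; join; combine; remQuot)
open import Data.Fin.Permutation using (↔⇒≡)
open import Data.Fin.Properties
  using (splitAt-join; join-splitAt; toℕ-combine; remQuot-combine; combine-remQuot; toℕ<n; any?)
open import Data.List using (List; []; _∷_; length)
open import Data.List.Membership.Propositional using (_∈_)
open import Data.List.Relation.Unary.Any using (here; there)
open import Data.List.Relation.Unary.Unique.Propositional using (Unique)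
open import Data.Maybe using (Maybe; just; nothing)
open import Data.Nat
  using (ℕ; zero; suc; _+_; _*_; _∸_; _^_; _/_; _%_; _≤_; _<_; z≤n; s≤s; _≤ᵇ_; _≡ᵇ_; ⌈_/2⌉)
open import Data.Nat.DivMod using (+-distrib-/; m*n%n≡0; m<n⇒m%n≡m; m*n/n≡m; m<n⇒m/n≡0)
open import Data.Nat.Induction using (<-rec)
open import Data.Nat.Properties
open import Data.Nat.Tactic.RingSolver using (solve-∀)
open import Data.Product using (_×_; Σ; Σ-syntax; ∃; ∃-syntax; _,_; proj₁; proj₂; uncurry)
open import Data.Sum using (_⊎_; inj₁; inj₂)
open import Data.Unit using (tt)
open import Data.Vec using (Vec; []; _∷_; lookup)
open import Data.Vec.Properties using (≡-dec)
open import Function.Bundles using (mk↔ₛ′)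
open import Function.Definitions using (Bijective)
open import Relation.Binary.PropositionalEquality
open import Relation.Nullary using (¬_; Dec; yes; no)

V : ℕ → Set
V = F₂^

⊕-comm : ∀ {n} (x y : V n) → x ⊕ y ≡ y ⊕ x
⊕-comm [] [] = refl
⊕-comm (a ∷ x) (b ∷ y) = cong₂ _∷_ (xor-comm a b) (⊕-comm x y)

⊕-assoc : ∀ {n} (x y z : V n) → (x ⊕ y) ⊕ z ≡ x ⊕ (y ⊕ z)
⊕-assoc [] [] [] = refl
⊕-assoc (a ∷ x) (b ∷ y) (c ∷ z) = cong₂ _∷_ (xor-assoc a b c) (⊕-assoc x y z)

⊕-idʳ : ∀ {n} (x : V n) → x ⊕ 𝟎 ≡ x
⊕-idʳ [] = refl
⊕-idʳ (a ∷ x) = cong₂ _∷_ (xor-identityʳ a) (⊕-idʳ x)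

⊕-idˡ : ∀ {n} (x : V n) → 𝟎 ⊕ x ≡ x
⊕-idˡ [] = refl
⊕-idˡ (a ∷ x) = cong (a ∷_) (⊕-idˡ x)

⊕-self : ∀ {n} (x : V n) → x ⊕ x ≡ 𝟎
⊕-self [] = refl
⊕-self (a ∷ x) = cong₂ _∷_ (xor-same a) (⊕-self x)

⊕-cancel : ∀ {n} (x y : V n) → (x ⊕ y) ⊕ y ≡ x
⊕-cancel x y = trans (⊕-assoc x y y) (trans (cong (x ⊕_) (⊕-self y)) (⊕-idʳ x))

⊕≡𝟎⇒≡ : ∀ {n} {x y : V n} → x ⊕ y ≡ 𝟎 → x ≡ y
⊕≡𝟎⇒≡ {x = x} {y} e = trans (sym (⊕-cancel x y)) (trans (cong (_⊕ y) e) (⊕-idˡ y))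

≡⊕⇒≡𝟎 : ∀ {n} {x y : V n} → x ≡ x ⊕ y → y ≡ 𝟎
≡⊕⇒≡𝟎 {x = x} {y} e = begin
  y             ≡⟨ sym (⊕-idˡ y) ⟩
  𝟎 ⊕ y         ≡⟨ cong (_⊕ y) (sym (⊕-self x)) ⟩
  (x ⊕ x) ⊕ y   ≡⟨ ⊕-assoc x x y ⟩
  x ⊕ (x ⊕ y)   ≡⟨ cong (x ⊕_) (sym e) ⟩
  x ⊕ x         ≡⟨ ⊕-self x ⟩
  𝟎             ∎
  where open ≡-Reasoning

⊕-mid : ∀ {n} (a b c d : V n) → (a ⊕ b) ⊕ (c ⊕ d) ≡ (a ⊕ c) ⊕ (b ⊕ d)
⊕-mid a b c d =
  trans (⊕-assoc a b (c ⊕ d))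
  (trans (cong (a ⊕_) (sym (⊕-assoc b c d)))
  (trans (cong (λ z → a ⊕ (z ⊕ d)) (⊕-comm b c))
  (trans (cong (a ⊕_) (⊕-assoc c b d)) (sym (⊕-assoc a c (b ⊕ d))))))

scale : ∀ {n} → Bool → V n → V n
scale false x = 𝟎
scale true x = x

scale-xor : ∀ {n} (b c : Bool) (x : V n) → scale (b xor c) x ≡ scale b x ⊕ scale c x
scale-xor false c x = sym (⊕-idˡ _)
scale-xor true false x = sym (⊕-idʳ x)
scale-xor true true x = sym (⊕-self x)

-- A normaliser for ⊕-expressions: an expression over k variables denotes the F₂-linear
-- combination nf e ∈ F₂^k of them, so two expressions with the same normal form agree.
data Expr (k : ℕ) : Set where
  var : Fin k → Expr k
  _⊞_ : Expr k → Expr k → Expr k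
infixl 20 _⊞_

⟦_⟧ : ∀ {k n} → Expr k → Vec (V n) k → V n
⟦ var i ⟧ ρ = lookup ρ i
⟦ e ⊞ f ⟧ ρ = ⟦ e ⟧ ρ ⊕ ⟦ f ⟧ ρ

combination : ∀ {k n} → Vec Bool k → Vec (V n) k → V n
combination [] [] = 𝟎
combination (b ∷ c) (x ∷ ρ) = scale b x ⊕ combination c ρ

unit : ∀ {k} → Fin k → Vec Bool k
unit zero = true ∷ 𝟎
unit (suc i) = false ∷ unit i

nf : ∀ {k} → Expr k → Vec Bool k
nf (var i) = unit i
nf (e ⊞ f) = nf e ⊕ nf f

combination-𝟎 : ∀ {k n} (ρ : Vec (V n) k) → combination 𝟎 ρ ≡ 𝟎
combination-𝟎 [] = refl
combination-𝟎 (x ∷ ρ) = trans (⊕-idˡ _) (combination-𝟎 ρ)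

combination-⊕ : ∀ {k n} (c c' : Vec Bool k) (ρ : Vec (V n) k) →
                combination (c ⊕ c') ρ ≡ combination c ρ ⊕ combination c' ρ
combination-⊕ [] [] [] = sym (⊕-idˡ 𝟎)
combination-⊕ (a ∷ c) (b ∷ c') (x ∷ ρ) =
  trans (cong₂ _⊕_ (scale-xor a b x) (combination-⊕ c c' ρ))
        (⊕-mid (scale a x) (scale b x) (combination c ρ) (combination c' ρ))

combination-unit : ∀ {k n} (i : Fin k) (ρ : Vec (V n) k) → combination (unit i) ρ ≡ lookup ρ i
combination-unit zero (x ∷ ρ) = trans (cong (x ⊕_) (combination-𝟎 ρ)) (⊕-idʳ x)
combination-unit (suc i) (x ∷ ρ) = trans (⊕-idˡ _) (combination-unit i ρ)

⟦⟧-nf : ∀ {k n} (e : Expr k) (ρ : Vec (V n) k) → ⟦ e ⟧ ρ ≡ combination (nf e) ρ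
⟦⟧-nf (var i) ρ = sym (combination-unit i ρ)
⟦⟧-nf (e ⊞ f) ρ = trans (cong₂ _⊕_ (⟦⟧-nf e ρ) (⟦⟧-nf f ρ)) (sym (combination-⊕ (nf e) (nf f) ρ))

⊕-solve : ∀ {k n} (e f : Expr k) → nf e ≡ nf f → (ρ : Vec (V n) k) → ⟦ e ⟧ ρ ≡ ⟦ f ⟧ ρ
⊕-solve e f eq ρ = trans (⟦⟧-nf e ρ) (trans (cong (λ c → combination c ρ) eq) (sym (⟦⟧-nf f ρ)))

x₀ : ∀ {k} → Expr (1 + k)
x₀ = var zero
x₁ : ∀ {k} → Expr (2 + k)
x₁ = var (suc zero)
x₂ : ∀ {k} → Expr (3 + k)
x₂ = var (suc (suc zero))
x₃ : ∀ {k} → Expr (4 + k)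
x₃ = var (suc (suc (suc zero)))
x₄ : ∀ {k} → Expr (5 + k)
x₄ = var (suc (suc (suc (suc zero))))
x₅ : ∀ {k} → Expr (6 + k)
x₅ = var (suc (suc (suc (suc (suc zero)))))
x₆ : ∀ {k} → Expr (7 + k)
x₆ = var (suc (suc (suc (suc (suc (suc zero))))))

record _≅_ (A B : Set) : Set where
  field
    to : A → B
    from : B → A
    to-from : ∀ b → to (from b) ≡ b
    from-to : ∀ a → from (to a) ≡ a
open _≅_ public

infix 3 _≅_
infixr 4 _∘≅_

≅-refl : ∀ {A} → A ≅ A
≅-refl = record { to = λ a → a ; from = λ a → a ; to-from = λ _ → refl ; from-to = λ _ → refl }

≅-sym : ∀ {A B} → A ≅ B → B ≅ A
≅-sym e = record { to = from e ; from = to e ; to-from = from-to e ; from-to = to-from e }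

_∘≅_ : ∀ {A B C} → A ≅ B → B ≅ C → A ≅ C
e ∘≅ f = record
  { to = λ a → to f (to e a)
  ; from = λ c → from e (from f c)
  ; to-from = λ c → trans (cong (to f) (to-from e (from f c))) (to-from f c)
  ; from-to = λ a → trans (cong (from e) (from-to f (to e a))) (from-to e a) }

×-cong : ∀ {A B C D} → A ≅ B → C ≅ D → (A × C) ≅ (B × D)
×-cong e f = record
  { to = λ { (a , c) → to e a , to f c }
  ; from = λ { (b , d) → from e b , from f d }
  ; to-from = λ { (b , d) → cong₂ _,_ (to-from e b) (to-from f d) }
  ; from-to = λ { (a , c) → cong₂ _,_ (from-to e a) (from-to f c) } }

⊎-cong : ∀ {A B C D} → A ≅ B → C ≅ D → (A ⊎ C) ≅ (B ⊎ D)
⊎-cong e f = record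
  { to = λ { (inj₁ a) → inj₁ (to e a) ; (inj₂ c) → inj₂ (to f c) }
  ; from = λ { (inj₁ b) → inj₁ (from e b) ; (inj₂ d) → inj₂ (from f d) }
  ; to-from = λ { (inj₁ b) → cong inj₁ (to-from e b) ; (inj₂ d) → cong inj₂ (to-from f d) }
  ; from-to = λ { (inj₁ a) → cong inj₁ (from-to e a) ; (inj₂ c) → cong inj₂ (from-to f c) } }

×-assoc : ∀ {A B C} → ((A × B) × C) ≅ (A × (B × C))
×-assoc = record
  { to = λ { ((a , b) , c) → a , (b , c) }
  ; from = λ { (a , (b , c)) → (a , b) , c }
  ; to-from = λ _ → refl ; from-to = λ _ → refl }

⊎-comm : ∀ {A B} → (A ⊎ B) ≅ (B ⊎ A)
⊎-comm = record
  { to = λ { (inj₁ a) → inj₂ a ; (inj₂ b) → inj₁ b }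
  ; from = λ { (inj₁ b) → inj₂ b ; (inj₂ a) → inj₁ a }
  ; to-from = λ { (inj₁ _) → refl ; (inj₂ _) → refl }
  ; from-to = λ { (inj₁ _) → refl ; (inj₂ _) → refl } }

Σ-fib : ∀ {A : Set} {F G : A → Set} → (∀ a → F a ≅ G a) → Σ A F ≅ Σ A G
Σ-fib e = record
  { to = λ { (a , x) → a , to (e a) x }
  ; from = λ { (a , y) → a , from (e a) y }
  ; to-from = λ { (a , y) → cong (a ,_) (to-from (e a) y) }
  ; from-to = λ { (a , x) → cong (a ,_) (from-to (e a) x) } }

Σ-⊎ : ∀ {A : Set} {F G : A → Set} → Σ A (λ a → F a ⊎ G a) ≅ (Σ A F ⊎ Σ A G)
Σ-⊎ = record
  { to = λ { (a , inj₁ x) → inj₁ (a , x) ; (a , inj₂ y) → inj₂ (a , y) }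
  ; from = λ { (inj₁ (a , x)) → a , inj₁ x ; (inj₂ (a , y)) → a , inj₂ y }
  ; to-from = λ { (inj₁ _) → refl ; (inj₂ _) → refl }
  ; from-to = λ { (a , inj₁ x) → refl ; (a , inj₂ y) → refl } }

Σ-Bool : ∀ {F : Bool → Set} → Σ Bool F ≅ (F false ⊎ F true)
Σ-Bool = record
  { to = λ { (false , x) → inj₁ x ; (true , x) → inj₂ x }
  ; from = λ { (inj₁ x) → false , x ; (inj₂ x) → true , x }
  ; to-from = λ { (inj₁ _) → refl ; (inj₂ _) → refl }
  ; from-to = λ { (false , x) → refl ; (true , x) → refl } }

Σ-× : ∀ {A B : Set} {F : A × B → Set} → Σ (A × B) F ≅ Σ A (λ a → Σ B (λ b → F (a , b)))
Σ-× = record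
  { to = λ { ((a , b) , x) → a , (b , x) }
  ; from = λ { (a , (b , x)) → (a , b) , x }
  ; to-from = λ _ → refl ; from-to = λ _ → refl }

Σ-×C : ∀ {A C : Set} {F : A → Set} → Σ A (λ a → F a × C) ≅ (Σ A F × C)
Σ-×C = record
  { to = λ { (a , (x , c)) → (a , x) , c }
  ; from = λ { ((a , x) , c) → a , (x , c) }
  ; to-from = λ _ → refl ; from-to = λ _ → refl }

Σ-reindex : ∀ {A B : Set} {F : B → Set} (e : A ≅ B) → Σ B F ≅ Σ A (λ a → F (to e a))
Σ-reindex {A} {B} {F} e = record
  { to = λ { (b , y) → from e b , subst F (sym (to-from e b)) y }
  ; from = λ { (a , x) → to e a , x }
  ; to-from = λ { (a , x) → back (from-to e a) (to-from e (to e a)) x }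
  ; from-to = λ { (b , y) → forth (to-from e b) y } }
  where
  forth : ∀ {b b'} (q : b' ≡ b) (y : F b) → (b' , subst F (sym q) y) ≡ (b , y)
  forth refl y = refl
  subst-loop : ∀ {c} (q : c ≡ c) (x : F c) → subst F (sym q) x ≡ x
  subst-loop refl x = refl
  back : ∀ {a a'} (p : a' ≡ a) (q : to e a' ≡ to e a) (x : F (to e a))
         → (a' , subst F (sym q) x) ≡ (a , x)
  back refl q x = cong (_ ,_) (subst-loop q x)

Fin-+ : ∀ a b → Fin (a + b) ≅ (Fin a ⊎ Fin b)
Fin-+ a b = record
  { to = splitAt a ; from = join a b
  ; to-from = splitAt-join a b ; from-to = join-splitAt a b }

Fin-cong : ∀ {a b} → a ≡ b → Fin a ≅ Fin b
Fin-cong refl = ≅-refl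

Fin-inj : ∀ {a b} → Fin a ≅ Fin b → a ≡ b
Fin-inj e = ↔⇒≡ (mk↔ₛ′ (to e) (from e) (to-from e) (from-to e))

Fin0⊎ : ∀ {A : Set} → (Fin 0 ⊎ A) ≅ A
Fin0⊎ = record
  { to = λ { (inj₂ a) → a } ; from = inj₂
  ; to-from = λ _ → refl ; from-to = λ { (inj₂ a) → refl } }

Fin-≤-split : ∀ {a b} → a ≤ b → Fin b ≅ (Fin a ⊎ Fin (b ∸ a))
Fin-≤-split {a} {b} le = Fin-cong (sym (m+[n∸m]≡n le)) ∘≅ Fin-+ a (b ∸ a)

Fin×Bool : ∀ c → (Fin c × Bool) ≅ Fin (c + c)
Fin×Bool c = record
  { to = λ { (i , false) → inj₁ i ; (i , true) → inj₂ i }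
  ; from = λ { (inj₁ i) → i , false ; (inj₂ i) → i , true }
  ; to-from = λ { (inj₁ i) → refl ; (inj₂ i) → refl }
  ; from-to = λ { (i , false) → refl ; (i , true) → refl } } ∘≅ ≅-sym (Fin-+ c c)

Fin×Bool² : ∀ c → (Fin c × (Bool × Bool)) ≅ Fin ((c + c) + (c + c))
Fin×Bool² c = ≅-sym ×-assoc ∘≅ ×-cong (Fin×Bool c) ≅-refl ∘≅ Fin×Bool (c + c)

cons≅ : ∀ {n} → (Bool × V n) ≅ V (suc n)
cons≅ = record
  { to = λ { (b , x) → b ∷ x }
  ; from = λ { (b ∷ x) → b , x }
  ; to-from = λ { (b ∷ x) → refl } ; from-to = λ _ → refl }

sumV : ∀ {n} → (V n → ℕ) → ℕ
sumV {zero} f = f []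
sumV {suc n} f = sumV (λ x → f (false ∷ x)) + sumV (λ x → f (true ∷ x))

Slots : ∀ {n} → (V n → ℕ) → Set
Slots {n} d = Σ (V n) (λ x → Fin (d x))

Slots≅Fin : ∀ {n} (d : V n → ℕ) → Slots d ≅ Fin (sumV d)
Slots≅Fin {zero} d = record
  { to = λ { ([] , i) → i } ; from = λ i → [] , i
  ; to-from = λ _ → refl ; from-to = λ { ([] , i) → refl } }
Slots≅Fin {suc n} d =
  Σ-reindex cons≅ ∘≅ Σ-× ∘≅ Σ-Bool ∘≅ ⊎-cong (Slots≅Fin _) (Slots≅Fin _) ∘≅ ≅-sym (Fin-+ _ _)

sumV-ext : ∀ {n} {f g : V n → ℕ} → (∀ x → f x ≡ g x) → sumV f ≡ sumV g
sumV-ext {zero} e = e []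
sumV-ext {suc n} e = cong₂ _+_ (sumV-ext (λ x → e (false ∷ x))) (sumV-ext (λ x → e (true ∷ x)))

sumV-+ : ∀ {n} (f g : V n → ℕ) → sumV (λ x → f x + g x) ≡ sumV f + sumV g
sumV-+ {zero} f g = refl
sumV-+ {suc n} f g =
  trans (cong₂ _+_ (sumV-+ (λ x → f (false ∷ x)) (λ x → g (false ∷ x)))
                   (sumV-+ (λ x → f (true ∷ x)) (λ x → g (true ∷ x))))
        (+-mid (sumV (λ x → f (false ∷ x))) _ _ _)
  where
  +-mid : ∀ a b c d → (a + b) + (c + d) ≡ (a + c) + (b + d)
  +-mid = solve-∀

sumV-0 : ∀ {n} → sumV {n} (λ _ → 0) ≡ 0
sumV-0 {zero} = refl
sumV-0 {suc n} = cong₂ _+_ (sumV-0 {n}) (sumV-0 {n})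

sumV-≤ : ∀ {n} {f g : V n → ℕ} → (∀ x → f x ≤ g x) → sumV f ≤ sumV g
sumV-≤ {zero} e = e []
sumV-≤ {suc n} e = +-mono-≤ (sumV-≤ (λ x → e (false ∷ x))) (sumV-≤ (λ x → e (true ∷ x)))

sumV-*c : ∀ {n} (f : V n → ℕ) c → sumV (λ x → f x * c) ≡ sumV f * c
sumV-*c {zero} f c = refl
sumV-*c {suc n} f c =
  trans (cong₂ _+_ (sumV-*c (λ x → f (false ∷ x)) c) (sumV-*c (λ x → f (true ∷ x)) c))
        (sym (*-distribʳ-+ c (sumV (λ x → f (false ∷ x))) _))

sumV-∸ : ∀ {n} (f g : V n → ℕ) → (∀ x → g x ≤ f x) →
         sumV (λ x → f x ∸ g x) ≡ sumV f ∸ sumV g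
sumV-∸ f g le = sym (begin
  sumV f ∸ sumV g                            ≡⟨ cong (_∸ sumV g) (sumV-ext (λ x → sym (m∸n+n≡m (le x)))) ⟩
  sumV (λ x → (f x ∸ g x) + g x) ∸ sumV g    ≡⟨ cong (_∸ sumV g) (sumV-+ (λ x → f x ∸ g x) g) ⟩
  (sumV (λ x → f x ∸ g x) + sumV g) ∸ sumV g ≡⟨ m+n∸n≡m (sumV (λ x → f x ∸ g x)) (sumV g) ⟩
  sumV (λ x → f x ∸ g x)                     ∎)
  where open ≡-Reasoning

eqV : ∀ {n} → V n → V n → Bool
eqV [] [] = true
eqV (false ∷ x) (false ∷ y) = eqV x y
eqV (true ∷ x) (true ∷ y) = eqV x y
eqV _ _ = false

eqV-refl : ∀ {n} (x : V n) → eqV x x ≡ true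
eqV-refl [] = refl
eqV-refl (false ∷ x) = eqV-refl x
eqV-refl (true ∷ x) = eqV-refl x

eqV-sound : ∀ {n} (x y : V n) → eqV x y ≡ true → x ≡ y
eqV-sound [] [] _ = refl
eqV-sound (false ∷ x) (false ∷ y) e = cong (false ∷_) (eqV-sound x y e)
eqV-sound (true ∷ x) (true ∷ y) e = cong (true ∷_) (eqV-sound x y e)

eqV-false : ∀ {n} (x y : V n) → ¬ (x ≡ y) → eqV x y ≡ false
eqV-false x y ne with eqV x y in eq
... | true = ⊥-elim (ne (eqV-sound x y eq))
... | false = refl

_≟ᵥ_ : ∀ {n} (x y : V n) → Dec (x ≡ y)
_≟ᵥ_ = ≡-dec _≟ᵇ_

pt : ∀ {n} → V n → ℕ → V n → ℕ
pt t c x = if eqV x t then c else 0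

sumV-pt : ∀ {n} (t : V n) c → sumV (pt t c) ≡ c
sumV-pt {zero} [] c = refl
sumV-pt {suc n} (false ∷ t) c =
  trans (cong₂ _+_ (sumV-pt t c) (sumV-0 {n})) (+-identityʳ c)
sumV-pt {suc n} (true ∷ t) c = trans (cong (_+ sumV (pt t c)) (sumV-0 {n})) (sumV-pt t c)

pt-≤ : ∀ {n} (f : V n → ℕ) (t x : V n) → pt t (f t) x ≤ f x
pt-≤ f t x with eqV x t in eq
... | true = ≤-reflexive (cong f (sym (eqV-sound x t eq)))
... | false = z≤n

single-≤ : ∀ {n} (f : V n → ℕ) (t : V n) → f t ≤ sumV f
single-≤ f t = subst (_≤ sumV f) (sumV-pt t (f t)) (sumV-≤ (pt-≤ f t))

sum0⇒0 : ∀ {n} (f : V n → ℕ) → sumV f ≡ 0 → ∀ x → f x ≡ 0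
sum0⇒0 f e x = n≤0⇒n≡0 (subst (f x ≤_) e (single-≤ f x))

sumpos⇒ : ∀ {n} (f : V n → ℕ) → 0 < sumV f → ∃[ x ] 0 < f x
sumpos⇒ {zero} f p = [] , p
sumpos⇒ {suc n} f p with sumV (λ x → f (false ∷ x)) in eq
... | suc _ = let (x , q) = sumpos⇒ (λ x → f (false ∷ x)) (subst (0 <_) (sym eq) (s≤s z≤n))
              in (false ∷ x) , q
... | zero = let (x , q) = sumpos⇒ (λ x → f (true ∷ x)) p in (true ∷ x) , q

argmax : ∀ {n} (f : V n → ℕ) → ∃[ t ] (∀ x → f x ≤ f t)
argmax {zero} f = [] , λ { [] → ≤-refl }
argmax {suc n} f with argmax (λ x → f (false ∷ x)) | argmax (λ x → f (true ∷ x))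
... | (a , pa) | (b , pb) with f (false ∷ a) ≤? f (true ∷ b)
...   | yes le = (true ∷ b) , λ { (false ∷ x) → ≤-trans (pa x) le ; (true ∷ x) → pb x }
...   | no nle = (false ∷ a) , λ { (false ∷ x) → pa x
                                 ; (true ∷ x) → ≤-trans (pb x) (<⇒≤ (≰⇒> nle)) }

pos : ℕ → ℕ
pos 0 = 0
pos (suc _) = 1

parity : ℕ → ℕ
parity 0 = 0
parity 1 = 1
parity (suc (suc n)) = parity n

pos-≤1 : ∀ a → pos a ≤ 1
pos-≤1 zero = z≤n
pos-≤1 (suc a) = s≤s z≤n

pos-+ : ∀ a b → pos (a + b) ≤ pos a + pos b
pos-+ zero b = ≤-refl
pos-+ (suc a) b = s≤s z≤n

pos-≤ : ∀ a → pos a ≤ a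
pos-≤ zero = z≤n
pos-≤ (suc a) = s≤s z≤n

pos-mono : ∀ {a b} → a ≤ b → pos a ≤ pos b
pos-mono {zero} _ = z≤n
pos-mono {suc a} {suc b} _ = ≤-refl

pos-suc : ∀ {a} → 0 < a → pos a ≡ 1
pos-suc {suc a} _ = refl

parity-≤1 : ∀ a → parity a ≤ 1
parity-≤1 0 = z≤n
parity-≤1 1 = s≤s z≤n
parity-≤1 (suc (suc a)) = parity-≤1 a

parity-≤-pos : ∀ a → parity a ≤ pos a
parity-≤-pos 0 = z≤n
parity-≤-pos 1 = s≤s z≤n
parity-≤-pos (suc (suc a)) = ≤-trans (parity-≤1 a) (s≤s z≤n)

parity-≤ : ∀ a → parity a ≤ a
parity-≤ 0 = z≤n
parity-≤ 1 = s≤s z≤n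
parity-≤ (suc (suc a)) = ≤-trans (parity-≤ a) (≤-trans (n≤1+n a) (n≤1+n (suc a)))

⌈/2⌉-double : ∀ a → ⌈ a /2⌉ + ⌈ a /2⌉ ≡ a + parity a
⌈/2⌉-double 0 = refl
⌈/2⌉-double 1 = refl
⌈/2⌉-double (suc (suc a)) = cong suc (trans (+-suc ⌈ a /2⌉ ⌈ a /2⌉) (cong suc (⌈/2⌉-double a)))

≤-⌈/2⌉-double : ∀ a → a ≤ ⌈ a /2⌉ + ⌈ a /2⌉
≤-⌈/2⌉-double a = subst (a ≤_) (sym (⌈/2⌉-double a)) (m≤m+n a (parity a))

⌈/2⌉-+ : ∀ a b → ⌈ a + b /2⌉ ≤ ⌈ a /2⌉ + ⌈ b /2⌉
⌈/2⌉-+ 0 b = ≤-refl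
⌈/2⌉-+ 1 0 = s≤s z≤n
⌈/2⌉-+ 1 1 = s≤s z≤n
⌈/2⌉-+ 1 (suc (suc b)) = s≤s (⌈/2⌉-+ 1 b)
⌈/2⌉-+ (suc (suc a)) b = s≤s (⌈/2⌉-+ a b)

pos-⌈/2⌉ : ∀ a → pos ⌈ a /2⌉ ≡ pos a
pos-⌈/2⌉ 0 = refl
pos-⌈/2⌉ 1 = refl
pos-⌈/2⌉ (suc (suc a)) = refl

half-≤ : ∀ {a b} → a + a ≤ b + b → a ≤ b
half-≤ {a} {b} le with a ≤? b
... | yes p = p
... | no np = ⊥-elim (<⇒≱ (+-mono-< (≰⇒> np) (≰⇒> np)) le)

2^-double : ∀ k → 2 ^ suc k ≡ 2 ^ k + 2 ^ k
2^-double k = cong (2 ^ k +_) (+-identityʳ (2 ^ k))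

-- A split of V (suc n) along t ≠ 0 is an isomorphism
-- V (suc n) ≅ V n × Bool of the form (y , b) ↦ sec y ⊕ b·t with sec linear; its first
-- component π is the quotient map V (suc n) → V (suc n) / ⟨t⟩ ≅ V n.
record Split {n} (t : V (suc n)) : Set where
  field
    iso : V (suc n) ≅ (V n × Bool)
    sec : V n → V (suc n)
    from-iso : ∀ y b → from iso (y , b) ≡ sec y ⊕ scale b t
    sec-lin : ∀ x y → sec (x ⊕ y) ≡ sec x ⊕ sec y
open Split public

private
  split-head : ∀ {n} (t' : V n) → Split (true ∷ t')
  split-head t' = record
    { iso = record
      { to = λ { (b ∷ x) → (x ⊕ scale b t') , b }
      ; from = λ { (y , b) → b ∷ (y ⊕ scale b t') }
      ; to-from = λ { (y , b) → cong (_, b) (⊕-cancel y (scale b t')) }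
      ; from-to = λ { (b ∷ x) → cong (b ∷_) (⊕-cancel x (scale b t')) } }
    ; sec = false ∷_
    ; from-iso = λ { y false → refl ; y true → refl }
    ; sec-lin = λ x y → refl }

  split-tail : ∀ {n} (t' : V (suc n)) → Split t' → Split (false ∷ t')
  split-tail t' S = record
    { iso = record
      { to = λ { (a ∷ x) → (a ∷ proj₁ (to (iso S) x)) , proj₂ (to (iso S) x) }
      ; from = λ { ((a ∷ z) , b) → a ∷ from (iso S) (z , b) }
      ; to-from = λ { ((a ∷ z) , b) → let e = to-from (iso S) (z , b) in
                        cong₂ (λ z' b' → (a ∷ z') , b') (cong proj₁ e) (cong proj₂ e) }
      ; from-to = λ { (a ∷ x) → cong (a ∷_) (from-to (iso S) x) } }
    ; sec = λ { (a ∷ z) → a ∷ sec S z }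
    ; from-iso = λ { (a ∷ z) false → cong₂ _∷_ (sym (xor-identityʳ a)) (from-iso S z false)
                   ; (a ∷ z) true → cong₂ _∷_ (sym (xor-identityʳ a)) (from-iso S z true) }
    ; sec-lin = λ { (a ∷ x) (b ∷ y) → cong ((a xor b) ∷_) (sec-lin S x y) } }

mkSplit : ∀ {n} (t : V (suc n)) → ¬ (t ≡ 𝟎) → Split t
mkSplit (true ∷ t') nz = split-head t'
mkSplit {zero} (false ∷ []) nz = ⊥-elim (nz refl)
mkSplit {suc n} (false ∷ t') nz = split-tail t' (mkSplit t' (λ e → nz (cong (false ∷_) e)))

module SplitProps {n} {t : V (suc n)} (S : Split t) where
  π : V (suc n) → V n
  π x = proj₁ (to (iso S) x)
  vb : V (suc n) → Bool
  vb x = proj₂ (to (iso S) x)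

  decomp : ∀ x → x ≡ sec S (π x) ⊕ scale (vb x) t
  decomp x = trans (sym (from-to (iso S) x)) (from-iso S (π x) (vb x))

  sec0 : sec S 𝟎 ≡ 𝟎
  sec0 = ≡⊕⇒≡𝟎 (trans (cong (sec S) (sym (⊕-self 𝟎))) (sec-lin S 𝟎 𝟎))

  scale-sec : ∀ b x → sec S (scale b x) ≡ scale b (sec S x)
  scale-sec false x = sec0
  scale-sec true x = refl

  from-𝟎-false : from (iso S) (𝟎 , false) ≡ 𝟎
  from-𝟎-false = trans (from-iso S 𝟎 false) (trans (⊕-idʳ _) sec0)

  from-𝟎-true : from (iso S) (𝟎 , true) ≡ t
  from-𝟎-true = trans (from-iso S 𝟎 true) (trans (cong (_⊕ t) sec0) (⊕-idˡ t))

  to-sec : ∀ y b → to (iso S) (sec S y ⊕ scale b t) ≡ (y , b)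
  to-sec y b = trans (cong (to (iso S)) (sym (from-iso S y b))) (to-from (iso S) (y , b))

  π-lin : ∀ x y → π (x ⊕ y) ≡ π x ⊕ π y
  π-lin x y = cong proj₁ (trans (cong (to (iso S)) sum) (to-sec (π x ⊕ π y) (vb x xor vb y)))
    where
    sum : x ⊕ y ≡ sec S (π x ⊕ π y) ⊕ scale (vb x xor vb y) t
    sum = trans (cong₂ _⊕_ (decomp x) (decomp y))
          (trans (⊕-mid (sec S (π x)) (scale (vb x) t) (sec S (π y)) (scale (vb y) t))
          (sym (cong₂ _⊕_ (sec-lin S (π x) (π y)) (scale-xor (vb x) (vb y) t))))

  π-𝟎 : π 𝟎 ≡ 𝟎
  π-𝟎 = trans (cong proj₁ (cong (to (iso S)) (sym from-𝟎-false))) (cong proj₁ (to-from (iso S) (𝟎 , false)))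

  π-t : π t ≡ 𝟎
  π-t = trans (cong proj₁ (cong (to (iso S)) (sym from-𝟎-true))) (cong proj₁ (to-from (iso S) (𝟎 , true)))

  π≡𝟎 : ∀ x → π x ≡ 𝟎 → (x ≡ 𝟎) ⊎ (x ≡ t)
  π≡𝟎 x e with vb x in ev
  ... | false = inj₁ (trans (decomp x) (trans (cong₂ (λ z b → sec S z ⊕ scale b t) e ev)
                       (trans (sym (from-iso S 𝟎 false)) from-𝟎-false)))
  ... | true = inj₂ (trans (decomp x) (trans (cong₂ (λ z b → sec S z ⊕ scale b t) e ev)
                      (trans (sym (from-iso S 𝟎 true)) from-𝟎-true)))

  π≢𝟎 : ∀ {x} → ¬ (x ≡ 𝟎) → ¬ (x ≡ t) → ¬ (π x ≡ 𝟎)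
  π≢𝟎 {x} n0 nt e with π≡𝟎 x e
  ... | inj₁ e' = n0 e'
  ... | inj₂ e' = nt e'

  Slots-fibres : (f : V (suc n) → ℕ) →
    Slots f ≅ Slots (λ y → f (from (iso S) (y , false)) + f (from (iso S) (y , true)))
  Slots-fibres f = Σ-reindex (≅-sym (iso S)) ∘≅ Σ-× ∘≅ Σ-fib (λ y → Σ-Bool ∘≅ ≅-sym (Fin-+ _ _))

  sumV-fibres : (f : V (suc n) → ℕ) →
    sumV f ≡ sumV (λ y → f (from (iso S) (y , false)) + f (from (iso S) (y , true)))
  sumV-fibres f = Fin-inj (≅-sym (Slots≅Fin f) ∘≅ Slots-fibres f ∘≅ Slots≅Fin _)

-- Pairings.  A pairing of V n indexed by P with labels lab gives every p ∈ P two pairs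
-- {u , u ⊕ lab p}, the 4|P| endpoints enumerating V n exactly once.
Pairing : ∀ n (P : Set) (lab : P → V n) → Set
Pairing n P lab = Σ[ e ∈ ((P × Bool × Bool) ≅ V n) ]
  (∀ p b → to e (p , b , true) ≡ to e (p , b , false) ⊕ lab p)

-- A partition of V n into pairs indexed by E, where the pair x has difference u whenever
-- ℓ x = just u and is unconstrained when ℓ x = nothing.
PartialPairing : ∀ n (E : Set) (ℓ : E → Maybe (V n)) → Set
PartialPairing n E ℓ = Σ[ e ∈ ((E × Bool) ≅ V n) ]
  (∀ x u → ℓ x ≡ just u → to e (x , true) ≡ to e (x , false) ⊕ u)

MultisetPairing : ∀ n → (V n → ℕ) → Set
MultisetPairing n d = Pairing n (Slots d) proj₁

Pairing⇒Partial : ∀ {n P lab} → Pairing n P lab →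
                  PartialPairing n (P × Bool) (λ pb → just (lab (proj₁ pb)))
Pairing⇒Partial (e , pr) = (×-assoc ∘≅ e) , λ { (p , b) u refl → pr p b }

Pairing-reindex : ∀ {n P Q lab} → Pairing n P lab → (σ : Q ≅ P) → Pairing n Q (λ q → lab (to σ q))
Pairing-reindex (e , pr) σ = (×-cong σ ≅-refl ∘≅ e) , λ q b → pr (to σ q) b

Pairing-relabel : ∀ {n P} {lab lab' : P → V n} → Pairing n P lab → (∀ p → lab p ≡ lab' p) →
                  Pairing n P lab'
Pairing-relabel (e , pr) eq = e , λ p b → trans (pr p b) (cong (to e (p , b , false) ⊕_) (eq p))

-- The preimage of a quotient pair {y , y ⊕ π x} is
-- {ŷ , ŷ ⊕ t , ŷ ⊕ x , ŷ ⊕ x ⊕ t}, which splits into two pairs of difference x; the preimage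
-- of any quotient pair splits into two pairs of difference t.
module Lift {n} {t : V (suc n)} (S : Split t)
  {E : Set} {ℓ : E → Maybe (V n)} (child : PartialPairing n E ℓ)
  {P : Set} (lab : P → V (suc n)) (σ : P ≅ E)
  (compat : ∀ p → (lab p ≡ t) ⊎ (ℓ (to σ p) ≡ just (SplitProps.π S (lab p)))) where

  open SplitProps S

  -- Within the fibre of a quotient pair, relabel the four points (b , c) so that c toggles x:
  -- the identity when x = t, and (b , c) ↦ (c , b xor (c ∧ ε)) when x has coordinate ε along t.
  twist : Bool → Bool → (Bool × Bool) ≅ (Bool × Bool)
  twist false _ = ≅-refl
  twist true ε = record
    { to = λ { (b , c) → c , (b xor (c ∧ ε)) }
    ; from = λ { (c , b) → (b xor (c ∧ ε)) , c }
    ; to-from = λ { (c , b) → cong (c ,_) (xor-cancel b (c ∧ ε)) }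
    ; from-to = λ { (b , c) → cong (_, c) (xor-cancel b (c ∧ ε)) } }
    where
    xor-cancel : ∀ x y → (x xor y) xor y ≡ x
    xor-cancel x y = trans (xor-assoc x y y) (trans (cong (x xor_) (xor-same y)) (xor-identityʳ x))

  projects : P → Bool
  projects p with compat p
  ... | inj₁ _ = false
  ... | inj₂ _ = true

  enumeration : (P × Bool × Bool) ≅ V (suc n)
  enumeration = Σ-fib (λ p → twist (projects p) (vb (lab p))) ∘≅ ×-cong σ ≅-refl ∘≅ ≅-sym ×-assoc
                ∘≅ ×-cong (proj₁ child) ≅-refl ∘≅ ≅-sym (iso S)

  pairs : ∀ p b → to enumeration (p , b , true) ≡ to enumeration (p , b , false) ⊕ lab p
  pairs p b with compat p
  ... | inj₁ eq =
    trans (from-iso S _ true)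
    (trans (cong (sec S (to (proj₁ child) (to σ p , b)) ⊕_) (sym eq))
    (cong (_⊕ lab p) (sym (trans (from-iso S _ false) (⊕-idʳ _)))))
  ... | inj₂ eq = begin
    from (iso S) (to (proj₁ child) (to σ p , true) , b xor ε)
      ≡⟨ from-iso S _ _ ⟩
    sec S (to (proj₁ child) (to σ p , true)) ⊕ scale (b xor ε) t
      ≡⟨ cong (λ z → sec S z ⊕ scale (b xor ε) t) (proj₂ child (to σ p) ū eq) ⟩
    sec S (y₀ ⊕ ū) ⊕ scale (b xor ε) t
      ≡⟨ cong₂ _⊕_ (sec-lin S y₀ ū) (scale-xor b ε t) ⟩
    (sec S y₀ ⊕ sec S ū) ⊕ (scale b t ⊕ scale ε t)
      ≡⟨ ⊕-mid (sec S y₀) (sec S ū) (scale b t) (scale ε t) ⟩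
    (sec S y₀ ⊕ scale b t) ⊕ (sec S ū ⊕ scale ε t)
      ≡⟨ cong₂ _⊕_ (cong (λ c → sec S y₀ ⊕ scale c t) (sym (xor-identityʳ b))) (sym (decomp (lab p))) ⟩
    (sec S y₀ ⊕ scale (b xor false) t) ⊕ lab p
      ≡⟨ cong (_⊕ lab p) (sym (from-iso S y₀ (b xor false))) ⟩
    from (iso S) (y₀ , b xor false) ⊕ lab p ∎
    where
    open ≡-Reasoning
    ε = vb (lab p)
    ū = π (lab p)
    y₀ = to (proj₁ child) (to σ p , false)

  lift : Pairing (suc n) P lab
  lift = enumeration , pairs

support : ∀ {n} → (V n → ℕ) → ℕ
support f = sumV (λ x → pos (f x))

odd-count : ∀ {n} → (V n → ℕ) → ℕ
odd-count f = sumV (λ x → parity (f x))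

Admissible : ∀ k → (V (suc (suc k)) → ℕ) → Set
Admissible k d = (d 𝟎 ≡ 0) × (sumV d ≡ 2 ^ k) × (support d ≤ suc (suc k))

ReducesTo : ∀ {n} (j : ℕ) → (V n → ℕ) → Set
ReducesTo {n} j d = Σ[ d' ∈ (V (suc (suc j)) → ℕ) ]
  Admissible j d' × (MultisetPairing (suc (suc j)) d' → MultisetPairing n d)

label≢𝟎 : ∀ {n} {d : V n → ℕ} → d 𝟎 ≡ 0 → ∀ {x} → 0 < d x → ¬ (x ≡ 𝟎)
label≢𝟎 {d = d} d0 p e = <⇒≢ p (sym (trans (cong d e) d0))

module Remove {n} (d : V n → ℕ) (t : V n) where
  others : V n → ℕ
  others x = if eqV x t then 0 else d x
  at-t : V n → ℕ
  at-t x = if eqV x t then d x else 0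

  slots-at : ∀ x → Fin (d x) ≅ (Fin (others x) ⊎ Fin (at-t x))
  slots-at x with eqV x t
  ... | true = ≅-sym Fin0⊎
  ... | false = ≅-sym Fin0⊎ ∘≅ ⊎-comm

  slots-at-cases : ∀ x (i : Fin (d x)) →
    (Σ[ j ∈ Fin (others x) ] to (slots-at x) i ≡ inj₁ j) ⊎ (eqV x t ≡ true)
  slots-at-cases x i with eqV x t
  ... | true = inj₂ refl
  ... | false = inj₁ (i , refl)

  slots-split : Slots d ≅ (Slots others ⊎ Slots at-t)
  slots-split = Σ-fib slots-at ∘≅ Σ-⊎

  at-t-pt : ∀ x → at-t x ≡ pt t (d t) x
  at-t-pt x with eqV x t in eq
  ... | true = cong d (eqV-sound x t eq)
  ... | false = refl

  sum-at-t : sumV at-t ≡ d t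
  sum-at-t = trans (sumV-ext at-t-pt) (sumV-pt t (d t))

  slots-at-t : Slots at-t ≅ Fin (d t)
  slots-at-t = Slots≅Fin at-t ∘≅ Fin-cong sum-at-t

  others+at-t : ∀ x → d x ≡ others x + at-t x
  others+at-t x with eqV x t
  ... | true = refl
  ... | false = sym (+-identityʳ (d x))

  sum-others : sumV d ≡ sumV others + d t
  sum-others = trans (sumV-ext others+at-t) (trans (sumV-+ others at-t) (cong (sumV others +_) sum-at-t))

  others-t : others t ≡ 0
  others-t rewrite eqV-refl t = refl

  others-≤ : ∀ x → others x ≤ d x
  others-≤ x with eqV x t
  ... | true = z≤n
  ... | false = ≤-refl

  support-others : 0 < d t → support d ≡ support others + 1
  support-others tpos = trans (sumV-ext pointwise)
    (trans (sumV-+ (λ x → pos (others x)) (pt t 1)) (cong (support others +_) (sumV-pt t 1)))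
    where
    pointwise : ∀ x → pos (d x) ≡ pos (others x) + pt t 1 x
    pointwise x with eqV x t in eq
    ... | true = trans (cong (λ z → pos (d z)) (eqV-sound x t eq)) (pos-suc tpos)
    ... | false = sym (+-identityʳ _)

  sum-⌈others/2⌉ : sumV (λ x → ⌈ others x /2⌉) + sumV (λ x → ⌈ others x /2⌉)
                   ≡ sumV others + odd-count others
  sum-⌈others/2⌉ = begin
    sumV (λ x → ⌈ others x /2⌉) + sumV (λ x → ⌈ others x /2⌉)
      ≡⟨ sym (sumV-+ (λ x → ⌈ others x /2⌉) (λ x → ⌈ others x /2⌉)) ⟩
    sumV (λ x → ⌈ others x /2⌉ + ⌈ others x /2⌉)
      ≡⟨ sumV-ext (λ x → ⌈/2⌉-double (others x)) ⟩
    sumV (λ x → others x + parity (others x))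
      ≡⟨ sumV-+ others (λ x → parity (others x)) ⟩
    sumV others + odd-count others ∎
    where open ≡-Reasoning

record Padding {m} (C : V (suc m) → ℕ) (N B : ℕ) : Set where
  field
    padded : V (suc m) → ℕ
    padded-𝟎 : padded 𝟎 ≡ 0
    padded-sum : sumV padded ≡ N
    padded-support : support padded ≤ B
    below-padded : ∀ y → C y ≤ padded y

pad : ∀ {m} (C : V (suc m) → ℕ) (N B : ℕ) → C 𝟎 ≡ 0 → sumV C ≤ N → support C ≤ B → 1 ≤ B →
      Padding C N B
pad {m} C N B C0 sC pC B1 = record
  { padded = d' ; padded-𝟎 = d'0 ; padded-sum = sum-d' ; padded-support = support-d'
  ; below-padded = λ y → m≤m+n (C y) _ }
  where
  s : ℕ
  s = N ∸ sumV C
  target : Σ[ y₀ ∈ V (suc m) ] (¬ (y₀ ≡ 𝟎)) × ((0 < C y₀) ⊎ (∀ y → C y ≡ 0))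
  target with sumV C in eq
  ... | zero = (true ∷ 𝟎) , (λ ()) , inj₂ (sum0⇒0 C eq)
  ... | suc _ with sumpos⇒ C (subst (0 <_) (sym eq) (s≤s z≤n))
  ...   | (y₀ , p) = y₀ , label≢𝟎 {d = C} C0 p , inj₁ p
  y₀ : V (suc m)
  y₀ = proj₁ target
  d' : V (suc m) → ℕ
  d' y = C y + pt y₀ s y
  d'0 : d' 𝟎 ≡ 0
  d'0 = cong₂ _+_ C0 (cong (λ b → if b then s else 0) (eqV-false 𝟎 y₀ (λ e → proj₁ (proj₂ target) (sym e))))
  sum-d' : sumV d' ≡ N
  sum-d' = trans (sumV-+ C (pt y₀ s)) (trans (cong (sumV C +_) (sumV-pt y₀ s)) (m+[n∸m]≡n sC))
  support-d' : support d' ≤ B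
  support-d' with proj₂ (proj₂ target)
  ... | inj₁ p = ≤-trans (sumV-≤ pointwise) pC
    where
    pointwise : ∀ y → pos (d' y) ≤ pos (C y)
    pointwise y with eqV y y₀ in eq
    ... | true rewrite eqV-sound y y₀ eq = ≤-reflexive (pos-absorb (C y₀) s p)
      where
      pos-absorb : ∀ a b → 0 < a → pos (a + b) ≡ pos a
      pos-absorb (suc a) b _ = refl
    ... | false = ≤-reflexive (cong pos (+-identityʳ (C y)))
  ... | inj₂ C≡0 = ≤-trans (sumV-≤ pointwise) (≤-trans (≤-reflexive (sumV-pt y₀ 1)) B1)
    where
    pointwise : ∀ y → pos (d' y) ≤ pt y₀ 1 y
    pointwise y with eqV y y₀
    ... | true rewrite C≡0 y = pos-≤1 s
    ... | false rewrite C≡0 y = z≤n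

-- If d' is a multiset on V m whose doubled
-- slots have room for D, the remaining room being exactly d t, then a pairing for d' lifts
-- to a pairing for d: each slot of D takes one of the 2·d' y places over y, and the copies
-- of t take the free places.
module OneStep {m} (d : V (suc m) → ℕ) (t : V (suc m)) (nz : ¬ (t ≡ 𝟎)) where
  S : Split t
  S = mkSplit t nz
  open SplitProps S
  open Remove d t

  D : V m → ℕ
  D y = others (from (iso S) (y , false)) + others (from (iso S) (y , true))

  module _ (d' : V m → ℕ) (room : ∀ y → D y ≤ d' y + d' y)
           (free : sumV (λ y → (d' y + d' y) ∸ D y) ≡ d t) where

    Places : Set
    Places = Slots d' × Bool

    places : Places ≅ (Slots D ⊎ Fin (d t))
    places = ≅-sym Σ-×C ∘≅ Σ-fib (λ y → Fin×Bool (d' y) ∘≅ Fin-≤-split (room y)) ∘≅ Σ-⊎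
             ∘≅ ⊎-cong ≅-refl (Slots≅Fin _ ∘≅ Fin-cong free)

    assign : Slots d ≅ Places
    assign = slots-split ∘≅ ⊎-cong (Slots-fibres others) slots-at-t ∘≅ ≅-sym places

    assign-compatible : ∀ p → (proj₁ p ≡ t) ⊎ (just (proj₁ (proj₁ (to assign p))) ≡ just (π (proj₁ p)))
    assign-compatible (x , i) with slots-at-cases x i
    ... | inj₂ e = inj₁ (eqV-sound x t e)
    ... | inj₁ (j , e) = inj₂ (cong (λ z → just (proj₁ (proj₁ (from places
                           (to (⊎-cong (Slots-fibres others) slots-at-t) (to Σ-⊎ (x , z))))))) e)

    lift-one : MultisetPairing m d' → MultisetPairing (suc m) d
    lift-one child = Lift.lift S (Pairing⇒Partial child) proj₁ assign assign-compatible

-- If at most M = d t other labels have odd multiplicity, the halved projection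
-- ⌈D/2⌉, padded to total 2^k, is admissible one level down and satisfies the hypotheses of
-- OneStep: admissible multisets with few odd multiplicities reduce by one level.
reduce-one : ∀ {k} (d : V (suc (suc (suc k))) → ℕ) → Admissible (suc k) d →
  ∀ t → 0 < d t → odd-count (Remove.others d t) ≤ d t → ReducesTo k d
reduce-one {k} d (d0 , sum , supp) t tpos few-odd =
  d' , (padded-𝟎 , padded-sum , padded-support) , OneStep.lift-one d t nz d' room free
  where
  nz = label≢𝟎 {d = d} d0 tpos
  open OneStep d t nz using (S; D)
  open SplitProps S
  open Remove d t

  C : V (suc (suc k)) → ℕ
  C y = ⌈ D y /2⌉

  C0 : C 𝟎 ≡ 0
  C0 = cong ⌈_/2⌉ (cong₂ _+_
    (trans (cong others from-𝟎-false) (n≤0⇒n≡0 (subst (others 𝟎 ≤_) d0 (others-≤ 𝟎))))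
    (trans (cong others from-𝟎-true) others-t))

  -- Σ ⌈D/2⌉ ≤ Σ ⌈others/2⌉ = (|others| + odd) / 2 ≤ (|others| + d t) / 2 = 2^k.
  sum-C : sumV C ≤ 2 ^ k
  sum-C = begin
    sumV C
      ≤⟨ sumV-≤ (λ y → ⌈/2⌉-+ (others (from (iso S) (y , false))) (others (from (iso S) (y , true)))) ⟩
    sumV (λ y → ⌈ others (from (iso S) (y , false)) /2⌉ + ⌈ others (from (iso S) (y , true)) /2⌉)
      ≡⟨ sym (sumV-fibres (λ x → ⌈ others x /2⌉)) ⟩
    sumV (λ x → ⌈ others x /2⌉)
      ≤⟨ half-≤ doubled ⟩
    2 ^ k ∎
    where
    open ≤-Reasoning
    doubled : sumV (λ x → ⌈ others x /2⌉) + sumV (λ x → ⌈ others x /2⌉) ≤ 2 ^ k + 2 ^ k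
    doubled = begin
      sumV (λ x → ⌈ others x /2⌉) + sumV (λ x → ⌈ others x /2⌉) ≡⟨ sum-⌈others/2⌉ ⟩
      sumV others + odd-count others                          ≤⟨ +-monoʳ-≤ (sumV others) few-odd ⟩
      sumV others + d t                                       ≡⟨ sym sum-others ⟩
      sumV d                                                  ≡⟨ trans sum (2^-double k) ⟩
      2 ^ k + 2 ^ k                                           ∎

  supp-C : support C ≤ suc (suc k)
  supp-C = begin
    support C
      ≡⟨ sumV-ext (λ y → pos-⌈/2⌉ (D y)) ⟩
    support D
      ≤⟨ sumV-≤ (λ y → pos-+ (others (from (iso S) (y , false))) (others (from (iso S) (y , true)))) ⟩
    sumV (λ y → pos (others (from (iso S) (y , false))) + pos (others (from (iso S) (y , true))))
      ≡⟨ sym (sumV-fibres (λ x → pos (others x))) ⟩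
    support others
      ≤⟨ ≤-pred (subst (_≤ suc (suc (suc k))) (+-comm (support others) 1)
                 (subst (_≤ suc (suc (suc k))) (support-others tpos) supp)) ⟩
    suc (suc k) ∎
    where open ≤-Reasoning

  open Padding (pad C (2 ^ k) (suc (suc k)) C0 sum-C supp-C (s≤s z≤n))
  d' : V (suc (suc k)) → ℕ
  d' = padded

  room : ∀ y → D y ≤ d' y + d' y
  room y = ≤-trans (≤-⌈/2⌉-double (D y)) (+-mono-≤ (below-padded y) (below-padded y))

  free : sumV (λ y → (d' y + d' y) ∸ D y) ≡ d t
  free = begin
    sumV (λ y → (d' y + d' y) ∸ D y)  ≡⟨ sumV-∸ (λ y → d' y + d' y) D room ⟩
    sumV (λ y → d' y + d' y) ∸ sumV D ≡⟨ cong₂ _∸_ (trans (sumV-+ d' d') (cong₂ _+_ padded-sum padded-sum))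
                                                  (sym (sumV-fibres others)) ⟩
    (2 ^ k + 2 ^ k) ∸ sumV others      ≡⟨ cong (_∸ sumV others) (trans (sym (2^-double k)) (trans (sym sum) sum-others)) ⟩
    (sumV others + d t) ∸ sumV others  ≡⟨ m+n∸m≡n (sumV others) (d t) ⟩
    d t                                ∎
    where open ≡-Reasoning

-- The
-- partition is found by search and checked exhaustively (512 triples) by evaluation.

∧-true : ∀ {a b} → a ∧ b ≡ true → (a ≡ true) × (b ≡ true)
∧-true {true} {true} _ = refl , refl

allV : ∀ {n} → (V n → Bool) → Bool
allV {zero} p = p []
allV {suc n} p = allV (λ x → p (false ∷ x)) ∧ allV (λ x → p (true ∷ x))

allV-sound : ∀ {n} (p : V n → Bool) → allV p ≡ true → ∀ x → p x ≡ true
allV-sound {zero} p e [] = e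
allV-sound {suc n} p e (false ∷ x) = allV-sound (λ x → p (false ∷ x)) (proj₁ (∧-true e)) x
allV-sound {suc n} p e (true ∷ x) = allV-sound (λ x → p (true ∷ x)) (proj₂ (∧-true e)) x

firstV : ∀ {n} → (V n → Bool) → Maybe (V n)
firstV {zero} p = if p [] then just [] else nothing
firstV {suc n} p with firstV (λ x → p (false ∷ x))
... | just x = just (false ∷ x)
... | nothing with firstV (λ x → p (true ∷ x))
...   | just x = just (true ∷ x)
...   | nothing = nothing

fromMaybe : ∀ {A : Set} → A → Maybe A → A
fromMaybe a (just x) = x
fromMaybe a nothing = a

Endpoint : Set
Endpoint = Fin 4 × Bool

eqFin : ∀ {n} → Fin n → Fin n → Bool
eqFin zero zero = true
eqFin (suc i) (suc j) = eqFin i j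
eqFin _ _ = false

eqFin-sound : ∀ {n} (i j : Fin n) → eqFin i j ≡ true → i ≡ j
eqFin-sound zero zero _ = refl
eqFin-sound (suc i) (suc j) e = cong suc (eqFin-sound i j e)

eqBool : Bool → Bool → Bool
eqBool false false = true
eqBool true true = true
eqBool _ _ = false

eqBool-sound : ∀ a b → eqBool a b ≡ true → a ≡ b
eqBool-sound false false _ = refl
eqBool-sound true true _ = refl

eqEndpoint : Endpoint → Endpoint → Bool
eqEndpoint (i , a) (j , b) = eqFin i j ∧ eqBool a b

eqEndpoint-sound : ∀ u w → eqEndpoint u w ≡ true → u ≡ w
eqEndpoint-sound (i , a) (j , b) e =
  cong₂ _,_ (eqFin-sound i j (proj₁ (∧-true e))) (eqBool-sound a b (proj₂ (∧-true e)))

endpoints : List Endpoint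
endpoints = (zero , false) ∷ (zero , true) ∷ (suc zero , false) ∷ (suc zero , true)
  ∷ (suc (suc zero) , false) ∷ (suc (suc zero) , true)
  ∷ (suc (suc (suc zero)) , false) ∷ (suc (suc (suc zero)) , true) ∷ []

allList : ∀ {A : Set} → (A → Bool) → List A → Bool
allList p [] = true
allList p (u ∷ us) = p u ∧ allList p us

allList-sound : ∀ {A : Set} (p : A → Bool) us → allList p us ≡ true → ∀ {u} → u ∈ us → p u ≡ true
allList-sound p (u ∷ us) e (here refl) = proj₁ (∧-true e)
allList-sound p (u ∷ us) e (there m) = allList-sound p us (proj₂ (∧-true {p u} e)) m

every-endpoint : ∀ u → u ∈ endpoints
every-endpoint (zero , false) = here refl
every-endpoint (zero , true) = there (here refl)
every-endpoint (suc zero , false) = there (there (here refl))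
every-endpoint (suc zero , true) = there (there (there (here refl)))
every-endpoint (suc (suc zero) , false) = there (there (there (there (here refl))))
every-endpoint (suc (suc zero) , true) = there (there (there (there (there (here refl)))))
every-endpoint (suc (suc (suc zero)) , false) = there (there (there (there (there (there (here refl))))))
every-endpoint (suc (suc (suc zero)) , true) =
  there (there (there (there (there (there (there (here refl)))))))

-- The first endpoint satisfying p (the last one if none does).
findEndpoint : (Endpoint → Bool) → Endpoint
findEndpoint p = go endpoints
  where
  go : List Endpoint → Endpoint
  go [] = suc (suc (suc zero)) , true
  go (u ∷ us) = if p u then u else go us

differences : V 3 → V 3 → V 3 → Fin 4 → V 3
differences a b c zero = a
differences a b c (suc zero) = b
differences a b c (suc (suc zero)) = c
differences a b c (suc (suc (suc zero))) = (a ⊕ b) ⊕ c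

distinct : ∀ {k} → Vec (V 3) k → Bool
distinct [] = true
distinct (x ∷ xs) = notIn xs ∧ distinct xs
  where
  notIn : ∀ {k} → Vec (V 3) k → Bool
  notIn [] = true
  notIn (y ∷ ys) = not (eqV x y) ∧ notIn ys

-- Search for the starting points: 0 for the first pair, then two further starting points
-- (coded as one vector of V 6) keeping all endpoints distinct, then the last starting point.
halves : V 6 → V 3 × V 3
halves (a₀ ∷ a₁ ∷ a₂ ∷ b₀ ∷ b₁ ∷ b₂ ∷ []) = (a₀ ∷ a₁ ∷ a₂ ∷ []) , (b₀ ∷ b₁ ∷ b₂ ∷ [])

first-three : V 3 → V 3 → V 3 → V 3 → V 3 → Vec (V 3) 6
first-three a b c s₁ s₂ = 𝟎 ∷ a ∷ s₁ ∷ (s₁ ⊕ b) ∷ s₂ ∷ (s₂ ⊕ c) ∷ []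

starts₁₂ : V 3 → V 3 → V 3 → V 3 × V 3
starts₁₂ a b c = halves (fromMaybe 𝟎 (firstV (λ w →
  distinct (first-three a b c (proj₁ (halves w)) (proj₂ (halves w))))))

start₃ : V 3 → V 3 → V 3 → V 3
start₃ a b c = fromMaybe 𝟎 (firstV (λ y →
  distinct (y ∷ first-three a b c (proj₁ (starts₁₂ a b c)) (proj₂ (starts₁₂ a b c)))))

starts : V 3 → V 3 → V 3 → Fin 4 → V 3
starts a b c zero = 𝟎
starts a b c (suc zero) = proj₁ (starts₁₂ a b c)
starts a b c (suc (suc zero)) = proj₂ (starts₁₂ a b c)
starts a b c (suc (suc (suc zero))) = start₃ a b c

endpoint : V 3 → V 3 → V 3 → Endpoint → V 3
endpoint a b c (i , β) = starts a b c i ⊕ scale β (differences a b c i)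

endpoint⁻¹ : V 3 → V 3 → V 3 → V 3 → Endpoint
endpoint⁻¹ a b c y = findEndpoint (λ u → eqV (endpoint a b c u) y)

right-inverse left-inverse is-bijection : V 3 → V 3 → V 3 → Bool
right-inverse a b c = allV (λ y → eqV (endpoint a b c (endpoint⁻¹ a b c y)) y)
left-inverse a b c = allList (λ u → eqEndpoint (endpoint⁻¹ a b c (endpoint a b c u)) u) endpoints
is-bijection a b c = right-inverse a b c ∧ left-inverse a b c

admissible-triple : V 3 → V 3 → V 3 → Bool
admissible-triple a b c =
  not (eqV a 𝟎) ∧ not (eqV b 𝟎) ∧ not (eqV c 𝟎) ∧ not (eqV ((a ⊕ b) ⊕ c) 𝟎)

triple-ok : V 3 → V 3 → V 3 → Bool
triple-ok a b c = not (admissible-triple a b c) ∨ is-bijection a b c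

all-triples : allV (λ a → allV (λ b → allV (λ c → triple-ok a b c))) ≡ true
all-triples = refl

pairing-F₂³ : ∀ a b c → ¬ (a ≡ 𝟎) → ¬ (b ≡ 𝟎) → ¬ (c ≡ 𝟎) → ¬ ((a ⊕ b) ⊕ c ≡ 𝟎)
  → PartialPairing 3 (Fin 4) (λ i → just (differences a b c i))
pairing-F₂³ a b c na nb nc ns = enumeration , pairs
  where
  instance-ok : triple-ok a b c ≡ true
  instance-ok = allV-sound (triple-ok a b) (allV-sound (λ b → allV (triple-ok a b))
                  (allV-sound (λ a → allV (λ b → allV (triple-ok a b))) all-triples a) b) c
  admissible : admissible-triple a b c ≡ true
  admissible rewrite eqV-false a 𝟎 na | eqV-false b 𝟎 nb | eqV-false c 𝟎 nc
                   | eqV-false ((a ⊕ b) ⊕ c) 𝟎 ns = refl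
  bijective : is-bijection a b c ≡ true
  bijective = subst (λ z → (not z ∨ is-bijection a b c) ≡ true) admissible instance-ok
  enumeration : (Fin 4 × Bool) ≅ V 3
  enumeration = record
    { to = endpoint a b c ; from = endpoint⁻¹ a b c
    ; to-from = λ y → eqV-sound _ _ (allV-sound (λ y → eqV (endpoint a b c (endpoint⁻¹ a b c y)) y)
                                        (proj₁ (∧-true {right-inverse a b c} bijective)) y)
    ; from-to = λ u → eqEndpoint-sound _ _ (allList-sound
                        (λ u → eqEndpoint (endpoint⁻¹ a b c (endpoint a b c u)) u) endpoints
                        (proj₂ (∧-true {right-inverse a b c} bijective)) (every-endpoint u)) }
  pairs : ∀ i u → just (differences a b c i) ≡ just u → endpoint a b c (i , true) ≡ endpoint a b c (i , false) ⊕ u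
  pairs i u refl = cong (_⊕ differences a b c i) (sym (⊕-idʳ (starts a b c i)))

pairing-F₂³-doubled : (a c : V 3) → ¬ (a ≡ 𝟎) → ¬ (c ≡ 𝟎) →
                      Pairing 3 Bool (λ g → if g then c else a)
pairing-F₂³-doubled a c na nc = enumeration , pairs
  where
  a⊕a⊕c : (a ⊕ a) ⊕ c ≡ c
  a⊕a⊕c = trans (cong (_⊕ c) (⊕-self a)) (⊕-idˡ c)
  four = pairing-F₂³ a a c na na nc (λ h → nc (trans (sym a⊕a⊕c) h))
  index : (Bool × Bool) ≅ Fin 4
  index = record
    { to = λ { (false , false) → zero ; (false , true) → suc zero
             ; (true , false) → suc (suc zero) ; (true , true) → suc (suc (suc zero)) }
    ; from = λ { zero → false , false ; (suc zero) → false , true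
               ; (suc (suc zero)) → true , false ; (suc (suc (suc zero))) → true , true }
    ; to-from = λ { zero → refl ; (suc zero) → refl ; (suc (suc zero)) → refl ; (suc (suc (suc zero))) → refl }
    ; from-to = λ { (false , false) → refl ; (false , true) → refl ; (true , false) → refl ; (true , true) → refl } }
  enumeration : (Bool × Bool × Bool) ≅ V 3
  enumeration = ≅-sym ×-assoc ∘≅ ×-cong index ≅-refl ∘≅ proj₁ four
  pairs : ∀ g b → to enumeration (g , b , true) ≡ to enumeration (g , b , false) ⊕ (if g then c else a)
  pairs false false = proj₂ four zero a refl
  pairs false true = proj₂ four (suc zero) a refl
  pairs true false = proj₂ four (suc (suc zero)) c refl
  pairs true true = proj₂ four (suc (suc (suc zero))) c (cong just a⊕a⊕c)

-- Four distinct nonzero labels w₀ , … , w₃ in V 4, each used for two pairs, pair up V 4.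
-- We lift a pairing of V 3 along a suitable vector t: with S = w₀ ⊕ w₁ ⊕ w₂ ⊕ w₃, take
-- t = w₀ ⊕ w₁ if S = 0, t = S if S is no label, t = w₃ if S ∈ {w₀ , w₁ , w₂}, t = w₀ if S = w₃;
-- in each case three projected labels and their sum are nonzero, as pairing-F₂³ needs.
module FourLabels (w : Fin 4 → V 4) (distinct-w : ∀ i j → w i ≡ w j → i ≡ j)
                  (nonzero : ∀ i → ¬ (w i ≡ 𝟎)) where
  f₀ f₁ f₂ f₃ : Fin 4
  f₀ = zero
  f₁ = suc zero
  f₂ = suc (suc zero)
  f₃ = suc (suc (suc zero))

  w₀ w₁ w₂ w₃ : V 4
  w₀ = w f₀
  w₁ = w f₁
  w₂ = w f₂
  w₃ = w f₃
  ws : Vec (V 4) 4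
  ws = w₀ ∷ w₁ ∷ w₂ ∷ w₃ ∷ []
  Sw : V 4
  Sw = ((w₀ ⊕ w₁) ⊕ w₂) ⊕ w₃

  ≢⇒w≢ : ∀ i j → ¬ (i ≡ j) → ¬ (w i ≡ w j)
  ≢⇒w≢ i j n e = n (distinct-w i j e)

  w₀₁₂ : (w₀ ⊕ w₁) ⊕ w₂ ≡ Sw ⊕ w₃
  w₀₁₂ = ⊕-solve ((x₀ ⊞ x₁) ⊞ x₂) ((((x₀ ⊞ x₁) ⊞ x₂) ⊞ x₃) ⊞ x₃) refl ws

  module Along (t : V 4) (nz : ¬ (t ≡ 𝟎)) where
    S : Split t
    S = mkSplit t nz
    open SplitProps S public

    lift-four : (a b c : V 3) → ¬ (a ≡ 𝟎) → ¬ (b ≡ 𝟎) → ¬ (c ≡ 𝟎) → ¬ ((a ⊕ b) ⊕ c ≡ 𝟎)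
          → (∀ i → (w i ≡ t) ⊎ (differences a b c i ≡ π (w i))) → Pairing 4 (Fin 4) w
    lift-four a b c na nb nc ns compat = Lift.lift S (pairing-F₂³ a b c na nb nc ns) w ≅-refl compat'
      where
      compat' : ∀ i → (w i ≡ t) ⊎ (just (differences a b c i) ≡ just (π (w i)))
      compat' i with compat i
      ... | inj₁ e = inj₁ e
      ... | inj₂ e = inj₂ (cong just e)

    π-lin3 : ∀ x y z → π ((x ⊕ y) ⊕ z) ≡ (π x ⊕ π y) ⊕ π z
    π-lin3 x y z = trans (π-lin (x ⊕ y) z) (cong (_⊕ π z) (π-lin x y))

  sum-zero : Sw ≡ 𝟎 → Pairing 4 (Fin 4) w
  sum-zero S≡0 = lift-four (π w₀) (π w₁) (π w₂) nz₀ nz₁ nz₂ nz₃ compat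
    where
    t = w₀ ⊕ w₁
    open Along t (λ e → ≢⇒w≢ f₀ f₁ (λ ()) (⊕≡𝟎⇒≡ e))
    w₃≡ : (w₀ ⊕ w₁) ⊕ w₂ ≡ w₃
    w₃≡ = trans w₀₁₂ (trans (cong (_⊕ w₃) S≡0) (⊕-idˡ w₃))
    nz₀ : ¬ (π w₀ ≡ 𝟎)
    nz₀ = π≢𝟎 (nonzero f₀) (λ e → nonzero f₁ (≡⊕⇒≡𝟎 e))
    nz₁ : ¬ (π w₁ ≡ 𝟎)
    nz₁ = π≢𝟎 (nonzero f₁) (λ e → nonzero f₀ (≡⊕⇒≡𝟎 (trans e (⊕-comm w₀ w₁))))
    nz₂ : ¬ (π w₂ ≡ 𝟎)
    nz₂ = π≢𝟎 (nonzero f₂) (λ e → nonzero f₃ (sym (trans (sym (⊕-self w₂)) (trans (cong (_⊕ w₂) e) w₃≡))))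
    sum≡ : (π w₀ ⊕ π w₁) ⊕ π w₂ ≡ π w₃
    sum≡ = trans (sym (π-lin3 w₀ w₁ w₂)) (cong π w₃≡)
    nz₃ : ¬ ((π w₀ ⊕ π w₁) ⊕ π w₂ ≡ 𝟎)
    nz₃ h = π≢𝟎 (nonzero f₃) (λ e → nonzero f₂ (≡⊕⇒≡𝟎 (sym (trans (cong (_⊕ w₂) e) w₃≡))))
                  (trans (sym sum≡) h)
    compat : ∀ i → (w i ≡ t) ⊎ (differences (π w₀) (π w₁) (π w₂) i ≡ π (w i))
    compat zero = inj₂ refl
    compat (suc zero) = inj₂ refl
    compat (suc (suc zero)) = inj₂ refl
    compat (suc (suc (suc zero))) = inj₂ sum≡

  sum-not-label : ¬ (Sw ≡ 𝟎) → (∀ l → ¬ (Sw ≡ w l)) → Pairing 4 (Fin 4) w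
  sum-not-label S≢0 S∉w = lift-four (π w₀) (π w₁) (π w₂) (nz f₀) (nz f₁) (nz f₂) nz₃ compat
    where
    open Along Sw S≢0
    nz : ∀ l → ¬ (π (w l) ≡ 𝟎)
    nz l = π≢𝟎 (nonzero l) (λ e → S∉w l (sym e))
    sum≡ : (π w₀ ⊕ π w₁) ⊕ π w₂ ≡ π w₃
    sum≡ = trans (sym (π-lin3 w₀ w₁ w₂))
           (trans (cong π w₀₁₂) (trans (π-lin Sw w₃) (trans (cong (_⊕ π w₃) π-t) (⊕-idˡ _))))
    nz₃ : ¬ ((π w₀ ⊕ π w₁) ⊕ π w₂ ≡ 𝟎)
    nz₃ h = nz f₃ (trans (sym sum≡) h)
    compat : ∀ i → (w i ≡ Sw) ⊎ (differences (π w₀) (π w₁) (π w₂) i ≡ π (w i))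
    compat zero = inj₂ refl
    compat (suc zero) = inj₂ refl
    compat (suc (suc zero)) = inj₂ refl
    compat (suc (suc (suc zero))) = inj₂ sum≡

  sum-is-early-label : (j : Fin 4) → ¬ (j ≡ f₃) → Sw ≡ w j → Pairing 4 (Fin 4) w
  sum-is-early-label j j≢3 S≡wj =
    lift-four (π w₀) (π w₁) (π w₂) (nz f₀ (λ ())) (nz f₁ (λ ())) (nz f₂ (λ ())) nz₃ compat
    where
    open Along w₃ (nonzero f₃)
    nz : ∀ l → ¬ (l ≡ f₃) → ¬ (π (w l) ≡ 𝟎)
    nz l l≢3 = π≢𝟎 (nonzero l) (λ e → l≢3 (distinct-w l f₃ e))
    -- π w₀ ⊕ π w₁ ⊕ π w₂ = π (w j ⊕ w₃), and w j ⊕ w₃ ∉ {0 , w₃}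
    nz₃ : ¬ ((π w₀ ⊕ π w₁) ⊕ π w₂ ≡ 𝟎)
    nz₃ h with π≡𝟎 (w j ⊕ w₃) (trans (cong (λ z → π (z ⊕ w₃)) (sym S≡wj))
                                (trans (cong π (sym w₀₁₂)) (trans (π-lin3 w₀ w₁ w₂) h)))
    ... | inj₁ e = j≢3 (distinct-w j f₃ (⊕≡𝟎⇒≡ e))
    ... | inj₂ e = nonzero j (≡⊕⇒≡𝟎 (sym (trans (⊕-comm w₃ (w j)) e)))
    compat : ∀ i → (w i ≡ w₃) ⊎ (differences (π w₀) (π w₁) (π w₂) i ≡ π (w i))
    compat zero = inj₂ refl
    compat (suc zero) = inj₂ refl
    compat (suc (suc zero)) = inj₂ refl
    compat (suc (suc (suc zero))) = inj₁ refl

  sum-is-last-label : Sw ≡ w₃ → Pairing 4 (Fin 4) w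
  sum-is-last-label S≡w₃ = lift-four (π x) (π w₁) (π w₂) nzx (nz f₁ (λ ())) (nz f₂ (λ ())) nz₃ compat
    where
    open Along w₀ (nonzero f₀)
    x = (w₁ ⊕ w₂) ⊕ w₃
    x≡ : x ≡ w₃ ⊕ w₀
    x≡ = trans (⊕-solve ((x₁ ⊞ x₂) ⊞ x₃) ((((x₀ ⊞ x₁) ⊞ x₂) ⊞ x₃) ⊞ x₀) refl ws) (cong (_⊕ w₀) S≡w₃)
    nzx : ¬ (π x ≡ 𝟎)
    nzx = π≢𝟎 (λ e → ≢⇒w≢ f₃ f₀ (λ ()) (⊕≡𝟎⇒≡ (trans (sym x≡) e)))
              (λ e → nonzero f₃ (≡⊕⇒≡𝟎 (sym (trans (⊕-comm w₀ w₃) (trans (sym x≡) e)))))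
    nz : ∀ l → ¬ (l ≡ f₀) → ¬ (π (w l) ≡ 𝟎)
    nz l l≢0 = π≢𝟎 (nonzero l) (λ e → l≢0 (distinct-w l f₀ e))
    sum≡ : (π x ⊕ π w₁) ⊕ π w₂ ≡ π w₃
    sum≡ = trans (sym (π-lin3 x w₁ w₂)) (cong π (⊕-solve ((((x₁ ⊞ x₂) ⊞ x₃) ⊞ x₁) ⊞ x₂) x₃ refl ws))
    nz₃ : ¬ ((π x ⊕ π w₁) ⊕ π w₂ ≡ 𝟎)
    nz₃ h = π≢𝟎 (nonzero f₃) (≢⇒w≢ f₃ f₀ (λ ())) (trans (sym sum≡) h)
    compat : ∀ i → (w i ≡ w₀) ⊎ (differences (π x) (π w₁) (π w₂) i ≡ π (w i))
    compat zero = inj₁ refl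
    compat (suc zero) = inj₂ refl
    compat (suc (suc zero)) = inj₂ refl
    compat (suc (suc (suc zero))) = inj₂ sum≡

  pairing-four : Pairing 4 (Fin 4) w
  pairing-four with Sw ≟ᵥ 𝟎 | any? (λ j → Sw ≟ᵥ w j)
  ... | yes S≡0 | _ = sum-zero S≡0
  ... | no _ | yes (zero , e) = sum-is-early-label f₀ (λ ()) e
  ... | no _ | yes (suc zero , e) = sum-is-early-label f₁ (λ ()) e
  ... | no _ | yes (suc (suc zero) , e) = sum-is-early-label f₂ (λ ()) e
  ... | no _ | yes (suc (suc (suc zero)) , e) = sum-is-last-label e
  ... | no S≢0 | no S∉w = sum-not-label S≢0 (λ l e → S∉w (l , e))

-- The labels outside the plane project to the multiset
-- others (fibre sums with the fibre over 0 removed).  The preimage of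
-- a quotient pair {y , y ⊕ ȳ} is an 8-element coset with coordinates in V 3 (along lifts of
-- ȳ , π₁ t₂ , t₁); it is assigned two slots of d, whose labels have coordinates
-- ξ ∈ V 3 ∖ {0}, and is paired by pairing-F₂³-doubled.
module TwoStep {n} (d : V (suc (suc n)) → ℕ) (d0 : d 𝟎 ≡ 0) (t₁ t₂ : V (suc (suc n)))
               (nz₁ : ¬ (t₁ ≡ 𝟎)) (nz₂ : ¬ (t₂ ≡ 𝟎)) (t₂≢t₁ : ¬ (t₂ ≡ t₁)) where
  S₁ : Split t₁
  S₁ = mkSplit t₁ nz₁
  module A₁ = SplitProps S₁
  u₂ : V (suc n)
  u₂ = A₁.π t₂
  S₂ : Split u₂
  S₂ = mkSplit u₂ (A₁.π≢𝟎 nz₂ t₂≢t₁)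
  module A₂ = SplitProps S₂

  Π : V (suc (suc n)) → V n
  Π x = A₂.π (A₁.π x)

  D₁ : V (suc n) → ℕ
  D₁ z = d (from (iso S₁) (z , false)) + d (from (iso S₁) (z , true))
  D₂ : V n → ℕ
  D₂ y = D₁ (from (iso S₂) (y , false)) + D₁ (from (iso S₂) (y , true))

  fibres : Slots d ≅ Slots D₂
  fibres = A₁.Slots-fibres d ∘≅ A₂.Slots-fibres D₁

  module R = Remove D₂ 𝟎

  decompose : ∀ x → x ≡ (sec S₁ (sec S₂ (Π x)) ⊕ scale (A₂.vb (A₁.π x)) (sec S₁ u₂))
                       ⊕ scale (A₁.vb x) t₁
  decompose x = trans (A₁.decomp x) (cong (_⊕ scale (A₁.vb x) t₁)
    (trans (cong (sec S₁) (A₂.decomp (A₁.π x)))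
      (trans (sec-lin S₁ _ _) (cong (sec S₁ (sec S₂ (Π x)) ⊕_) (A₁.scale-sec (A₂.vb (A₁.π x)) u₂)))))

  module _ (d'' : V n → ℕ)
     (room : ∀ y → R.others y ≤ (d'' y + d'' y) + (d'' y + d'' y))
     (free : sumV (λ y → ((d'' y + d'' y) + (d'' y + d'' y)) ∸ R.others y) ≡ D₂ 𝟎) where

    -- The places: a slot of d'', one of its two pairs, and one of two halves of the coset.
    Pairs : Set
    Pairs = Slots d'' × Bool

    places : (Pairs × Bool) ≅ (Slots R.others ⊎ Fin (D₂ 𝟎))
    places = ×-assoc ∘≅ ≅-sym Σ-×C ∘≅ Σ-fib (λ y → Fin×Bool² (d'' y) ∘≅ Fin-≤-split (room y)) ∘≅ Σ-⊎
             ∘≅ ⊎-cong ≅-refl (Slots≅Fin _ ∘≅ Fin-cong free)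

    opaque
      assign : Slots d ≅ (Pairs × Bool)
      assign = fibres ∘≅ R.slots-split ∘≅ ⊎-cong ≅-refl R.slots-at-t ∘≅ ≅-sym places

    ȳ : Pairs → V n
    ȳ e = proj₁ (proj₁ e)

    opaque
     unfolding assign
     assign-compatible : ∀ p → (Π (proj₁ p) ≡ 𝟎) ⊎ (Π (proj₁ p) ≡ ȳ (proj₁ (to assign p)))
     assign-compatible (x , i) with R.slots-at-cases (proj₁ (to fibres (x , i))) (proj₂ (to fibres (x , i)))
     ... | inj₂ e = inj₁ (eqV-sound _ _ e)
     ... | inj₁ (j , e) = inj₂ (sym (cong (λ z → ȳ (proj₁ (from places (to (⊎-cong ≅-refl R.slots-at-t)
                             (to Σ-⊎ (proj₁ (to fibres (x , i)) , z)))))) e))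

    projects : Slots d → Bool
    projects p with assign-compatible p
    ... | inj₁ _ = false
    ... | inj₂ _ = true

    -- Coordinates of a label within the coset of its pair.
    ξ : Slots d → V 3
    ξ p = projects p ∷ A₁.vb (proj₁ p) ∷ A₂.vb (A₁.π (proj₁ p)) ∷ []

    ξ≢𝟎 : ∀ p → ¬ (ξ p ≡ 𝟎)
    ξ≢𝟎 (x , i) e with assign-compatible (x , i)
    ξ≢𝟎 (x , i) () | inj₂ _
    ... | inj₁ Πx≡0 = no-slot (subst (λ z → Fin (d z)) x≡0 i)
      where
      x≡0 : x ≡ 𝟎
      x≡0 = trans (decompose x)
        (trans (cong₂ (λ a b → (sec S₁ (sec S₂ (Π x)) ⊕ scale a (sec S₁ u₂)) ⊕ scale b t₁)
                      (cong (λ { (_ ∷ _ ∷ b ∷ _) → b }) e) (cong (λ { (_ ∷ b ∷ _) → b }) e))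
        (trans (⊕-idʳ _) (trans (⊕-idʳ _) (trans (cong (λ z → sec S₁ (sec S₂ z)) Πx≡0)
          (trans (cong (sec S₁) A₂.sec0) A₁.sec0)))))
      no-slot : Fin (d 𝟎) → ⊥
      no-slot j = subst (λ m → Fin m → ⊥) (sym d0) (λ ()) j

    block : (e : Pairs) → Pairing 3 Bool (λ g → ξ (from assign (e , g)))
    block e = Pairing-relabel (pairing-F₂³-doubled (ξ (from assign (e , false))) (ξ (from assign (e , true)))
                                 (ξ≢𝟎 _) (ξ≢𝟎 _))
                              (λ { false → refl ; true → refl })

    child-enumeration : (Pairs × Bool) ≅ V n → (Pairs × (Bool × (Bool × Bool))) ≅ V (suc (suc n))
    child-enumeration c = reorder ∘≅ ×-cong (×-cong c ≅-refl) ≅-refl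
                          ∘≅ ×-cong (≅-sym (iso S₂)) ≅-refl ∘≅ ≅-sym (iso S₁)
      where
      reorder : (Pairs × (Bool × (Bool × Bool))) ≅ (((Pairs × Bool) × Bool) × Bool)
      reorder = record { to = λ { (e , (c₀ , (c₁ , c₂))) → ((e , c₀) , c₂) , c₁ }
                       ; from = λ { (((e , c₀) , c₂) , c₁) → e , (c₀ , (c₁ , c₂)) }
                       ; to-from = λ _ → refl ; from-to = λ _ → refl }

    V3≅ : V 3 ≅ (Bool × (Bool × Bool))
    V3≅ = record
      { to = λ { (c₀ ∷ c₁ ∷ c₂ ∷ []) → c₀ , (c₁ , c₂) }
      ; from = λ { (c₀ , (c₁ , c₂)) → c₀ ∷ c₁ ∷ c₂ ∷ [] }
      ; to-from = λ _ → refl ; from-to = λ { (c₀ ∷ c₁ ∷ c₂ ∷ []) → refl } }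

    module _ (child : MultisetPairing n d'') where
      cosets : (Pairs × (Bool × (Bool × Bool))) ≅ V (suc (suc n))
      cosets = child-enumeration (proj₁ (Pairing⇒Partial child))

      enumeration : (Slots d × Bool × Bool) ≅ V (suc (suc n))
      enumeration = ×-cong assign ≅-refl ∘≅ ×-assoc ∘≅ Σ-fib (λ e → proj₁ (block e) ∘≅ V3≅) ∘≅ cosets

      point : Pairs → V 3 → V (suc (suc n))
      point e c = to cosets (e , to V3≅ c)

      û₂ : V (suc (suc n))
      û₂ = sec S₁ u₂
      ŷ base : Pairs → V (suc (suc n))
      ŷ e = sec S₁ (sec S₂ (ȳ e))
      base e = sec S₁ (sec S₂ (to (proj₁ (Pairing⇒Partial child)) (e , false)))

      offset : Pairs → V 3 → V (suc (suc n))
      offset e (c₀ ∷ c₁ ∷ c₂ ∷ []) = (scale c₀ (ŷ e) ⊕ scale c₂ û₂) ⊕ scale c₁ t₁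

      point-form : ∀ e c₀ c₁ c₂ →
        point e (c₀ ∷ c₁ ∷ c₂ ∷ []) ≡ ((base e ⊕ scale c₀ (ŷ e)) ⊕ scale c₂ û₂) ⊕ scale c₁ t₁
      point-form e c₀ c₁ c₂ =
        trans (from-iso S₁ _ c₁) (cong (_⊕ scale c₁ t₁)
          (trans (cong (sec S₁) (from-iso S₂ _ c₂))
          (trans (sec-lin S₁ _ _)
          (cong₂ _⊕_
            (trans (cong (λ z → sec S₁ (sec S₂ z)) (child-pair c₀))
              (trans (cong (sec S₁) (sec-lin S₂ _ _))
                (trans (sec-lin S₁ _ _)
                  (cong (base e ⊕_) (trans (cong (sec S₁) (A₂.scale-sec c₀ (ȳ e))) (A₁.scale-sec c₀ _))))))
            (A₁.scale-sec c₂ u₂)))))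
        where
        child-pair : ∀ c₀ → to (proj₁ (Pairing⇒Partial child)) (e , c₀)
                           ≡ to (proj₁ (Pairing⇒Partial child)) (e , false) ⊕ scale c₀ (ȳ e)
        child-pair false = sym (⊕-idʳ _)
        child-pair true = proj₂ (Pairing⇒Partial child) e (ȳ e) refl

      point-⊕ : ∀ e c x → point e (c ⊕ x) ≡ point e c ⊕ offset e x
      point-⊕ e (c₀ ∷ c₁ ∷ c₂ ∷ []) (y₀ ∷ y₁ ∷ y₂ ∷ []) =
        trans (point-form e (c₀ xor y₀) (c₁ xor y₁) (c₂ xor y₂))
        (trans (cong₃ (λ a b c → ((base e ⊕ a) ⊕ b) ⊕ c)
                      (scale-xor c₀ y₀ (ŷ e)) (scale-xor c₂ y₂ û₂) (scale-xor c₁ y₁ t₁))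
        (trans (⊕-solve ((x₀ ⊞ (x₁ ⊞ x₂)) ⊞ (x₃ ⊞ x₄) ⊞ (x₅ ⊞ x₆))
                        ((((x₀ ⊞ x₁) ⊞ x₃) ⊞ x₅) ⊞ ((x₂ ⊞ x₄) ⊞ x₆)) refl
                  (base e ∷ scale c₀ (ŷ e) ∷ scale y₀ (ŷ e) ∷ scale c₂ û₂ ∷ scale y₂ û₂
                          ∷ scale c₁ t₁ ∷ scale y₁ t₁ ∷ []))
          (cong (_⊕ offset e (y₀ ∷ y₁ ∷ y₂ ∷ [])) (sym (point-form e c₀ c₁ c₂)))))
        where
        cong₃ : ∀ {a b c a' b' c'} (f : V (suc (suc n)) → V (suc (suc n)) → V (suc (suc n)) → V (suc (suc n)))
                → a ≡ a' → b ≡ b' → c ≡ c' → f a b c ≡ f a' b' c'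
        cong₃ f refl refl refl = refl

      offset-ξ : ∀ p → offset (proj₁ (to assign p)) (ξ p) ≡ proj₁ p
      offset-ξ (x , i) with assign-compatible (x , i)
      ... | inj₁ Πx≡0 = sym (trans (decompose x)
             (cong (λ z → (z ⊕ scale (A₂.vb (A₁.π x)) û₂) ⊕ scale (A₁.vb x) t₁)
               (trans (cong (λ z → sec S₁ (sec S₂ z)) Πx≡0) (trans (cong (sec S₁) A₂.sec0) A₁.sec0))))
      ... | inj₂ Πx≡ȳ = sym (trans (decompose x)
             (cong (λ z → (sec S₁ (sec S₂ z) ⊕ scale (A₂.vb (A₁.π x)) û₂) ⊕ scale (A₁.vb x) t₁) Πx≡ȳ))

      pairs : ∀ p b → to enumeration (p , b , true) ≡ to enumeration (p , b , false) ⊕ proj₁ p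
      pairs p b =
        trans (cong (point e) (proj₂ (block e) g b))
        (trans (point-⊕ e (to (proj₁ (block e)) (g , b , false)) (ξ (from assign (e , g))))
        (cong (point e (to (proj₁ (block e)) (g , b , false)) ⊕_)
          (trans (cong (λ q → offset e (ξ q)) (from-to assign p)) (offset-ξ p))))
        where
        e = proj₁ (to assign p)
        g = proj₂ (to assign p)

      lift-two : MultisetPairing (suc (suc n)) d
      lift-two = enumeration , pairs

⌈_/4⌉ : ℕ → ℕ
⌈ a /4⌉ = ⌈ ⌈ a /2⌉ /2⌉

⌈/4⌉-+ : ∀ a b → ⌈ a + b /4⌉ ≤ ⌈ a /4⌉ + ⌈ b /4⌉
⌈/4⌉-+ a b = ≤-trans (⌈n/2⌉-mono (⌈/2⌉-+ a b)) (⌈/2⌉-+ ⌈ a /2⌉ ⌈ b /2⌉)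

⌈/4⌉-+⁴ : ∀ a b c e → ⌈ (a + b) + (c + e) /4⌉ ≤ (⌈ a /4⌉ + ⌈ b /4⌉) + (⌈ c /4⌉ + ⌈ e /4⌉)
⌈/4⌉-+⁴ a b c e = ≤-trans (⌈/4⌉-+ (a + b) (c + e)) (+-mono-≤ (⌈/4⌉-+ a b) (⌈/4⌉-+ c e))

≤-⌈/4⌉-quadruple : ∀ a → a ≤ (⌈ a /4⌉ + ⌈ a /4⌉) + (⌈ a /4⌉ + ⌈ a /4⌉)
≤-⌈/4⌉-quadruple a = ≤-trans (≤-⌈/2⌉-double a) (+-mono-≤ (≤-⌈/2⌉-double ⌈ a /2⌉) (≤-⌈/2⌉-double ⌈ a /2⌉))

⌈/4⌉-small : ∀ a → a ≤ 4 → ⌈ a /4⌉ ≡ pos a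
⌈/4⌉-small 0 _ = refl
⌈/4⌉-small 1 _ = refl
⌈/4⌉-small 2 _ = refl
⌈/4⌉-small 3 _ = refl
⌈/4⌉-small 4 _ = refl
⌈/4⌉-small (suc (suc (suc (suc (suc a))))) (s≤s (s≤s (s≤s (s≤s ()))))

-- If all multiplicities are at most 4 and two distinct labels t₁ , t₂ occur, the quartered
-- projection ⌈others/4⌉ onto V (k + 2) has total and support at most support d - 2; so when
-- support d ≤ 2^k + 2 it can be padded to an admissible multiset satisfying the hypotheses
-- of TwoStep.
reduce-two : ∀ {k} (d : V (suc (suc (suc (suc k)))) → ℕ) → Admissible (suc (suc k)) d →
  support d ≤ 2 ^ k + 2 → (∀ x → d x ≤ 4) →
  ∀ t₁ t₂ → 0 < d t₁ → 0 < d t₂ → ¬ (t₂ ≡ t₁) → ReducesTo k d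
reduce-two {k} d (d0 , sum , supp) supp-small d≤4 t₁ t₂ p₁ p₂ t₂≢t₁ =
  d'' , (padded-𝟎 , padded-sum , padded-support) ,
  TwoStep.lift-two d d0 t₁ t₂ (label≢𝟎 {d = d} d0 p₁) (label≢𝟎 {d = d} d0 p₂) t₂≢t₁ d'' room free
  where
  open TwoStep d d0 t₁ t₂ (label≢𝟎 {d = d} d0 p₁) (label≢𝟎 {d = d} d0 p₂) t₂≢t₁
    using (S₁; S₂; module A₁; module A₂; Π; D₁; D₂; module R)

  outside : V (suc (suc (suc (suc k)))) → ℕ
  outside x = if eqV (Π x) 𝟎 then 0 else d x

  outside≤d : ∀ x → outside x ≤ d x
  outside≤d x with eqV (Π x) 𝟎
  ... | true = z≤n
  ... | false = ≤-refl

  lift₂ : V (suc (suc k)) → Bool → Bool → V (suc (suc (suc (suc k))))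
  lift₂ y b₂ b₁ = from (iso S₁) (from (iso S₂) (y , b₂) , b₁)

  fibre-sum : (V (suc (suc (suc (suc k)))) → ℕ) → V (suc (suc k)) → ℕ
  fibre-sum f y = (f (lift₂ y false false) + f (lift₂ y false true))
                + (f (lift₂ y true false) + f (lift₂ y true true))

  Π-lift₂ : ∀ y b₂ b₁ → Π (lift₂ y b₂ b₁) ≡ y
  Π-lift₂ y b₂ b₁ = trans (cong (λ z → A₂.π (proj₁ z)) (to-from (iso S₁) (from (iso S₂) (y , b₂) , b₁)))
                          (cong proj₁ (to-from (iso S₂) (y , b₂)))

  others≡ : ∀ y → R.others y ≡ fibre-sum outside y
  others≡ y with eqV y 𝟎 in e
  ... | true = sym (cong₂ _+_ (cong₂ _+_ (on-fibre false false) (on-fibre false true))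
                              (cong₂ _+_ (on-fibre true false) (on-fibre true true)))
    where
    on-fibre : ∀ b₂ b₁ → outside (lift₂ y b₂ b₁) ≡ 0
    on-fibre b₂ b₁ rewrite Π-lift₂ y b₂ b₁ | e = refl
  ... | false = sym (cong₂ _+_ (cong₂ _+_ (on-fibre false false) (on-fibre false true))
                               (cong₂ _+_ (on-fibre true false) (on-fibre true true)))
    where
    on-fibre : ∀ b₂ b₁ → outside (lift₂ y b₂ b₁) ≡ d (lift₂ y b₂ b₁)
    on-fibre b₂ b₁ rewrite Π-lift₂ y b₂ b₁ | e = refl

  C : V (suc (suc k)) → ℕ
  C y = ⌈ R.others y /4⌉

  sum-C≤ : sumV C ≤ support outside
  sum-C≤ = begin
    sumV C                              ≡⟨ sumV-ext (λ y → cong ⌈_/4⌉ (others≡ y)) ⟩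
    sumV (λ y → ⌈ fibre-sum outside y /4⌉)
      ≤⟨ sumV-≤ (λ y → ⌈/4⌉-+⁴ (outside (lift₂ y false false)) (outside (lift₂ y false true))
                              (outside (lift₂ y true false)) (outside (lift₂ y true true))) ⟩
    sumV (λ y → (q (lift₂ y false false) + q (lift₂ y false true))
              + (q (lift₂ y true false) + q (lift₂ y true true)))
      ≡⟨ sym (A₂.sumV-fibres (λ z → q (from (iso S₁) (z , false)) + q (from (iso S₁) (z , true)))) ⟩
    sumV (λ z → q (from (iso S₁) (z , false)) + q (from (iso S₁) (z , true)))
      ≡⟨ sym (A₁.sumV-fibres q) ⟩
    sumV q                              ≡⟨ sumV-ext (λ x → ⌈/4⌉-small (outside x) (≤-trans (outside≤d x) (d≤4 x))) ⟩
    support outside                     ∎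
    where
    open ≤-Reasoning
    q : V (suc (suc (suc (suc k)))) → ℕ
    q x = ⌈ outside x /4⌉

  Π-t₁ : Π t₁ ≡ 𝟎
  Π-t₁ = trans (cong A₂.π A₁.π-t) A₂.π-𝟎

  outside-plane : ∀ x → Π x ≡ 𝟎 → outside x ≡ 0
  outside-plane x e rewrite e | eqV-refl (𝟎 {suc (suc k)}) = refl

  -- t₁ and t₂ lie in the plane, so they leave the support.
  support-outside : support outside + 2 ≤ support d
  support-outside = begin
    support outside + 2
      ≡⟨ cong (support outside +_) (sym (cong₂ _+_ (sumV-pt t₁ 1) (sumV-pt t₂ 1))) ⟩
    support outside + (sumV (pt t₁ 1) + sumV (pt t₂ 1))
      ≡⟨ cong (support outside +_) (sym (sumV-+ (pt t₁ 1) (pt t₂ 1))) ⟩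
    support outside + sumV (λ x → pt t₁ 1 x + pt t₂ 1 x)
      ≡⟨ sym (sumV-+ (λ x → pos (outside x)) (λ x → pt t₁ 1 x + pt t₂ 1 x)) ⟩
    sumV (λ x → pos (outside x) + (pt t₁ 1 x + pt t₂ 1 x))
      ≤⟨ sumV-≤ pointwise ⟩
    support d ∎
    where
    open ≤-Reasoning
    at-t₁ : pos (outside t₁) + (1 + pt t₂ 1 t₁) ≤ pos (d t₁)
    at-t₁ = subst₂ (λ a b → pos a + (1 + b) ≤ pos (d t₁)) (sym (outside-plane t₁ Π-t₁))
                   (cong (λ b → if b then 1 else 0) (sym (eqV-false t₁ t₂ (λ e → t₂≢t₁ (sym e)))))
                   (≤-reflexive (sym (pos-suc p₁)))
    at-t₂ : pos (outside t₂) + (0 + 1) ≤ pos (d t₂)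
    at-t₂ = subst (λ a → pos a + 1 ≤ pos (d t₂)) (sym (outside-plane t₂ A₂.π-t))
                  (≤-reflexive (sym (pos-suc p₂)))
    pointwise : ∀ x → pos (outside x) + (pt t₁ 1 x + pt t₂ 1 x) ≤ pos (d x)
    pointwise x with eqV x t₁ in e₁
    ... | true = subst (λ z → pos (outside z) + (1 + pt t₂ 1 z) ≤ pos (d z)) (sym (eqV-sound x t₁ e₁)) at-t₁
    ... | false with eqV x t₂ in e₂
    ...   | true = subst (λ z → pos (outside z) + (0 + 1) ≤ pos (d z)) (sym (eqV-sound x t₂ e₂)) at-t₂
    ...   | false = ≤-trans (≤-reflexive (+-identityʳ (pos (outside x)))) (pos-mono (outside≤d x))

  sum-C+2 : sumV C + 2 ≤ support d
  sum-C+2 = ≤-trans (+-monoˡ-≤ 2 sum-C≤) support-outside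

  C0 : C 𝟎 ≡ 0
  C0 = cong ⌈_/4⌉ R.others-t

  supp-C : support C ≤ suc (suc k)
  supp-C = ≤-trans (sumV-≤ (λ y → pos-≤ (C y)))
           (≤-pred (≤-pred (subst (_≤ suc (suc (suc (suc k)))) (+-comm (sumV C) 2) (≤-trans sum-C+2 supp))))

  sum-C : sumV C ≤ 2 ^ k
  sum-C = ≤-pred (≤-pred (subst₂ _≤_ (+-comm (sumV C) 2) (+-comm (2 ^ k) 2) (≤-trans sum-C+2 supp-small)))

  open Padding (pad C (2 ^ k) (suc (suc k)) C0 sum-C supp-C (s≤s z≤n))
  d'' : V (suc (suc k)) → ℕ
  d'' = padded

  room : ∀ y → R.others y ≤ (d'' y + d'' y) + (d'' y + d'' y)
  room y = ≤-trans (≤-⌈/4⌉-quadruple (R.others y)) (+-mono-≤ twice twice)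
    where
    twice : ⌈ R.others y /4⌉ + ⌈ R.others y /4⌉ ≤ d'' y + d'' y
    twice = +-mono-≤ (below-padded y) (below-padded y)

  free : sumV (λ y → ((d'' y + d'' y) + (d'' y + d'' y)) ∸ R.others y) ≡ D₂ 𝟎
  free = begin
    sumV (λ y → ((d'' y + d'' y) + (d'' y + d'' y)) ∸ R.others y)
      ≡⟨ sumV-∸ (λ y → (d'' y + d'' y) + (d'' y + d'' y)) R.others room ⟩
    sumV (λ y → (d'' y + d'' y) + (d'' y + d'' y)) ∸ sumV R.others
      ≡⟨ cong (_∸ sumV R.others) (trans (sumV-+ (λ y → d'' y + d'' y) (λ y → d'' y + d'' y))
            (cong₂ _+_ (trans (sumV-+ d'' d'') (cong₂ _+_ padded-sum padded-sum))
                       (trans (sumV-+ d'' d'') (cong₂ _+_ padded-sum padded-sum)))) ⟩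
    ((2 ^ k + 2 ^ k) + (2 ^ k + 2 ^ k)) ∸ sumV R.others
      ≡⟨ cong (_∸ sumV R.others) (trans (quadruple (2 ^ k)) (trans (sym sum) (trans total R.sum-others))) ⟩
    (sumV R.others + D₂ 𝟎) ∸ sumV R.others
      ≡⟨ m+n∸m≡n (sumV R.others) (D₂ 𝟎) ⟩
    D₂ 𝟎 ∎
    where
    open ≡-Reasoning
    quadruple : ∀ x → (x + x) + (x + x) ≡ 2 * (2 * x)
    quadruple = solve-∀
    total : sumV d ≡ sumV D₂
    total = trans (A₁.sumV-fibres d) (A₂.sumV-fibres D₁)

-- Let t be a label of maximal multiplicity M of an admissible d on
-- V (k + 2), and let the other labels have total Sd, support P and q odd multiplicities.
-- Then Sd + M = 2^k, P ≤ k + 1, q ≤ P, q ≤ Sd, Sd ≤ P·M, Sd + q is even, and Sd + q ≤ P·M if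
-- M is even.  If q > M, then M ≤ k, whence 2^k ≤ (k + 1)·k + k, so k ≤ 5; an exhaustive check
-- of these constraints leaves only k = 2 , M = 1 and k = 4 , M ≤ 4.

even? : ℕ → Bool
even? 0 = true
even? 1 = false
even? (suc (suc n)) = even? n

even?-double : ∀ c → even? (c + c) ≡ true
even?-double zero = refl
even?-double (suc c) = subst (λ z → even? z ≡ true) (sym (cong suc (+-suc c c))) (even?-double c)

parity-odd : ∀ a → even? a ≡ false → parity a ≡ 1
parity-odd 1 _ = refl
parity-odd (suc (suc a)) e = parity-odd a e

parity-even : ∀ a → even? a ≡ true → parity a ≡ 0
parity-even 0 _ = refl
parity-even (suc (suc a)) e = parity-even a e

≤-pos* : ∀ a M → a ≤ M → a ≤ pos a * M
≤-pos* zero M _ = z≤n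
≤-pos* (suc a) M le = subst (suc a ≤_) (sym (+-identityʳ M)) le

-- For even M, a + parity a ≤ pos a · M whenever a ≤ M (an odd a is then below M).
+parity-≤-pos* : ∀ a M → a ≤ M → even? M ≡ true → a + parity a ≤ pos a * M
+parity-≤-pos* a M le even-M with even? a in even-a
... | true = subst (_≤ pos a * M) (sym (trans (cong (a +_) (parity-even a even-a)) (+-identityʳ a)))
                   (≤-pos* a M le)
... | false = odd-case a le even-a
  where
  odd-case : ∀ a → a ≤ M → even? a ≡ false → a + parity a ≤ pos a * M
  odd-case (suc a') le odd = subst₂ _≤_ (sym (trans (cong (suc a' +_) (parity-odd (suc a') odd))
                                                     (+-comm (suc a') 1)))
                                        (sym (+-identityʳ M)) strict
    where
    strict : suc (suc a') ≤ M
    strict with m≤n⇒m<n∨m≡n le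
    ... | inj₁ l = l
    ... | inj₂ refl with trans (sym odd) even-M
    ...   | ()

≡true⇒T : ∀ {b} → b ≡ true → T b
≡true⇒T refl = tt

T⇒≡true : ∀ {b} → T b → b ≡ true
T⇒≡true {true} _ = refl

≤⇒≤ᵇ≡true : ∀ {m n} → m ≤ n → (m ≤ᵇ n) ≡ true
≤⇒≤ᵇ≡true le = T⇒≡true (≤⇒≤ᵇ le)

∧-intro : ∀ {a b} → a ≡ true → b ≡ true → a ∧ b ≡ true
∧-intro refl refl = refl

allUpTo : ℕ → (ℕ → Bool) → Bool
allUpTo zero p = p 0
allUpTo (suc n) p = allUpTo n p ∧ p (suc n)

allUpTo-sound : ∀ n p → allUpTo n p ≡ true → ∀ x → x ≤ n → p x ≡ true
allUpTo-sound zero p e .zero z≤n = e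
allUpTo-sound (suc n) p e x le with x ≤? n
... | yes le' = allUpTo-sound n p (proj₁ (∧-true e)) x le'
... | no nle with ≤-antisym le (≰⇒> nle)
...   | refl = proj₂ (∧-true {allUpTo n p} e)

constraints : ℕ → ℕ → ℕ → ℕ → Bool
constraints k M P q =
  (1 ≤ᵇ M) ∧ (M ≤ᵇ k) ∧ (suc M ≤ᵇ q) ∧ (q ≤ᵇ P) ∧ (suc P ≤ᵇ k + 2) ∧
  (q ≤ᵇ (2 ^ k ∸ M)) ∧ ((2 ^ k ∸ M) ≤ᵇ P * M) ∧ even? ((2 ^ k ∸ M) + q) ∧
  (not (even? M) ∨ ((2 ^ k ∸ M) + q ≤ᵇ P * M))

exceptional : ℕ → ℕ → Bool
exceptional k M = ((k ≡ᵇ 2) ∧ (M ≡ᵇ 1)) ∨ (k ≡ᵇ 4)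

constraints⇒exceptional : ℕ → ℕ → ℕ → ℕ → Bool
constraints⇒exceptional k M P q = not (constraints k M P q) ∨ exceptional k M

small-cases : allUpTo 5 (λ k → allUpTo 5 (λ M → allUpTo 6 (λ P → allUpTo 6 (λ q →
                constraints⇒exceptional k M P q)))) ≡ true
small-cases = refl

polynomial<2^ : ∀ j → suc (6 + j) * (6 + j) + (6 + j) < 2 ^ (6 + j)
polynomial<2^ zero = <ᵇ⇒< 48 64 tt
polynomial<2^ (suc j) = begin-strict
  f (suc j)       ≡⟨ step j ⟩
  f j + (2 * j + 15) ≤⟨ +-monoʳ-≤ (f j) (m≤m+n (2 * j + 15) (j * j + 12 * j + 33)) ⟩
  f j + ((2 * j + 15) + (j * j + 12 * j + 33)) ≡⟨ cong (f j +_) (expand j) ⟩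
  f j + f j       <⟨ +-mono-< (polynomial<2^ j) (polynomial<2^ j) ⟩
  2 ^ (6 + j) + 2 ^ (6 + j) ≡⟨ sym (2^-double (6 + j)) ⟩
  2 ^ (6 + suc j) ∎
  where
  open ≤-Reasoning
  f : ℕ → ℕ
  f j = suc (6 + j) * (6 + j) + (6 + j)
  step : ∀ j → suc (6 + suc j) * (6 + suc j) + (6 + suc j)
               ≡ (suc (6 + j) * (6 + j) + (6 + j)) + (2 * j + 15)
  step = solve-∀
  expand : ∀ j → (2 * j + 15) + (j * j + 12 * j + 33) ≡ suc (6 + j) * (6 + j) + (6 + j)
  expand = solve-∀

module Counting {k} (d : V (suc (suc k)) → ℕ) (sum : sumV d ≡ 2 ^ k)
  (supp : support d ≤ suc (suc k)) (t : V (suc (suc k))) (maximal : ∀ x → d x ≤ d t) where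
  open Remove d t

  M Sd P q : ℕ
  M = d t
  Sd = sumV others
  P = support others
  q = odd-count others

  M-pos : 0 < M
  M-pos = positive (d t) refl
    where
    open ≤-Reasoning
    positive : ∀ m → d t ≡ m → 0 < m
    positive (suc _) _ = s≤s z≤n
    positive zero e = ⊥-elim (<⇒≱ (m^n>0 2 k) (begin
      2 ^ k                 ≡⟨ sym sum ⟩
      sumV d                ≤⟨ sumV-≤ (λ x → subst (d x ≤_) e (maximal x)) ⟩
      sumV {suc (suc k)} (λ _ → 0) ≡⟨ sumV-0 {suc (suc k)} ⟩
      0                     ∎))

  Sd+M : Sd + M ≡ 2 ^ k
  Sd+M = trans (sym sum-others) sum

  Sd≡ : Sd ≡ 2 ^ k ∸ M
  Sd≡ = sym (trans (cong (_∸ M) (sym Sd+M)) (m+n∸n≡m Sd M))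

  P<k+2 : suc P ≤ suc (suc k)
  P<k+2 = subst (_≤ suc (suc k)) (trans (support-others M-pos) (+-comm P 1)) supp

  q≤P : q ≤ P
  q≤P = sumV-≤ (λ x → parity-≤-pos (others x))

  q≤Sd : q ≤ Sd
  q≤Sd = sumV-≤ (λ x → parity-≤ (others x))

  others≤M : ∀ x → others x ≤ M
  others≤M x = ≤-trans (others-≤ x) (maximal x)

  Sd≤P*M : Sd ≤ P * M
  Sd≤P*M = ≤-trans (sumV-≤ (λ x → ≤-pos* (others x) M (others≤M x)))
                   (≤-reflexive (sumV-*c (λ x → pos (others x)) M))

  Sd+q-even : even? (Sd + q) ≡ true
  Sd+q-even = subst (λ z → even? z ≡ true) sum-⌈others/2⌉ (even?-double (sumV (λ x → ⌈ others x /2⌉)))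

  Sd+q≤P*M : even? M ≡ true → Sd + q ≤ P * M
  Sd+q≤P*M even-M = ≤-trans (≤-reflexive (sym (sumV-+ others (λ x → parity (others x)))))
    (≤-trans (sumV-≤ (λ x → +parity-≤-pos* (others x) M (others≤M x) even-M))
             (≤-reflexive (sumV-*c (λ x → pos (others x)) M)))

  second-label : M < q → Σ[ t₂ ∈ V (suc (suc k)) ] (0 < d t₂) × ¬ (t₂ ≡ t)
  second-label M<q = t₂ , ≤-trans odd-pos (others-≤ t₂) , t₂≢t
    where
    odd-label : ∃[ x ] 0 < parity (others x)
    odd-label = sumpos⇒ (λ x → parity (others x)) (≤-trans (s≤s z≤n) M<q)
    t₂ : V (suc (suc k))
    t₂ = proj₁ odd-label
    odd-pos : 0 < others t₂
    odd-pos with others t₂ | proj₂ odd-label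
    ... | suc _ | _ = s≤s z≤n
    t₂≢t : ¬ (t₂ ≡ t)
    t₂≢t e = <⇒≢ odd-pos (sym (trans (cong others e) others-t))

  large-k : 6 ≤ k → M ≤ k → ⊥
  large-k k≥6 M≤k with (k ∸ 6) | m+[n∸m]≡n k≥6
  ... | j | refl = <⇒≱ (polynomial<2^ j) (begin
    2 ^ (6 + j)                    ≡⟨ sym Sd+M ⟩
    Sd + M                         ≤⟨ +-mono-≤ (≤-trans Sd≤P*M (*-mono-≤ (≤-pred P<k+2) M≤k)) M≤k ⟩
    suc (6 + j) * (6 + j) + (6 + j) ∎)
    where open ≤-Reasoning

  small-k : k ≤ 5 → M ≤ k → M < q → (k ≡ 2 × M ≡ 1) ⊎ (k ≡ 4 × M ≤ 4)
  small-k k≤5 M≤k M<q = decode (subst (λ h → (not h ∨ exceptional k M) ≡ true) holds checked)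
    where
    P≤6 : P ≤ 6
    P≤6 = ≤-trans (≤-pred P<k+2) (s≤s k≤5)
    checked : constraints⇒exceptional k M P q ≡ true
    checked = allUpTo-sound 6 (constraints⇒exceptional k M P)
      (allUpTo-sound 6 (λ P → allUpTo 6 (constraints⇒exceptional k M P))
        (allUpTo-sound 5 (λ M → allUpTo 6 (λ P → allUpTo 6 (constraints⇒exceptional k M P)))
          (allUpTo-sound 5 (λ k → allUpTo 5 (λ M → allUpTo 6 (λ P → allUpTo 6
            (constraints⇒exceptional k M P)))) small-cases k k≤5)
          M (≤-trans M≤k k≤5))
        P P≤6)
      q (≤-trans q≤P P≤6)
    parity-constraint : (not (even? M) ∨ ((2 ^ k ∸ M) + q ≤ᵇ P * M)) ≡ true
    parity-constraint with even? M in even-M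
    ... | false = refl
    ... | true = ≤⇒≤ᵇ≡true (subst (λ z → z + q ≤ P * M) Sd≡ (Sd+q≤P*M even-M))
    holds : constraints k M P q ≡ true
    holds = ∧-intro (≤⇒≤ᵇ≡true M-pos) (∧-intro (≤⇒≤ᵇ≡true M≤k) (∧-intro (≤⇒≤ᵇ≡true M<q)
      (∧-intro (≤⇒≤ᵇ≡true q≤P) (∧-intro (≤⇒≤ᵇ≡true (subst (suc P ≤_) (+-comm 2 k) P<k+2))
      (∧-intro (≤⇒≤ᵇ≡true (subst (q ≤_) Sd≡ q≤Sd)) (∧-intro (≤⇒≤ᵇ≡true (subst (_≤ P * M) Sd≡ Sd≤P*M))
      (∧-intro (subst (λ z → even? (z + q) ≡ true) Sd≡ Sd+q-even) parity-constraint)))))))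
    decode : exceptional k M ≡ true → (k ≡ 2 × M ≡ 1) ⊎ (k ≡ 4 × M ≤ 4)
    decode e with k ≡ᵇ 2 in e₂ | M ≡ᵇ 1 in e₁ | k ≡ᵇ 4 in e₄
    ... | true | true | _ = inj₁ (≡ᵇ⇒≡ k 2 (≡true⇒T e₂) , ≡ᵇ⇒≡ M 1 (≡true⇒T e₁))
    ... | _ | _ | true = inj₂ (≡ᵇ⇒≡ k 4 (≡true⇒T e₄) , subst (M ≤_) (≡ᵇ⇒≡ k 4 (≡true⇒T e₄)) M≤k)
    decode () | false | _ | false
    decode () | true | false | false

  dichotomy : (q ≤ M) ⊎ (M < q × ((k ≡ 2 × M ≡ 1) ⊎ (k ≡ 4 × M ≤ 4)))
  dichotomy with q ≤? M
  ... | yes q≤M = inj₁ q≤M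
  ... | no q≰M with M ≤? k | k ≤? 5
  ...   | no M≰k | _ = ⊥-elim (q≰M (≤-trans q≤P (≤-trans (≤-pred P<k+2) (≰⇒> M≰k))))
  ...   | yes M≤k | no k≰5 = ⊥-elim (large-k (≰⇒> k≰5) M≤k)
  ...   | yes M≤k | yes k≤5 = inj₂ (≰⇒> q≰M , small-k k≤5 M≤k (≰⇒> q≰M))

Fin-pos : ∀ {m} → Fin m → 0 < m
Fin-pos {suc m} _ = s≤s z≤n

-- Base case n = 2: the single slot has a label label₀ ≠ 0, and the two cosets of ⟨label₀⟩
-- in V 2 are its two pairs (lifted from the trivial pairing of V 1).
pairing-base : (d : V 2 → ℕ) → d 𝟎 ≡ 0 → sumV d ≡ 1 → MultisetPairing 2 d
pairing-base d d0 sum = Lift.lift S quotient proj₁ single all-label₀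
  where
  single : Slots d ≅ Fin 1
  single = Slots≅Fin d ∘≅ Fin-cong sum
  label₀ : V 2
  label₀ = proj₁ (from single zero)
  S : Split label₀
  S = mkSplit label₀ (label≢𝟎 {d = d} d0 (Fin-pos (proj₂ (from single zero))))
  quotient : PartialPairing 1 (Fin 1) (λ _ → nothing)
  quotient = record { to = λ { (_ , b) → b ∷ [] } ; from = λ { (b ∷ []) → zero , b }
                    ; to-from = λ { (b ∷ []) → refl } ; from-to = λ { (zero , b) → refl } } , λ _ u ()
  all-label₀ : ∀ p → (proj₁ p ≡ label₀) ⊎ (nothing ≡ just (SplitProps.π S (proj₁ p)))
  all-label₀ p = inj₁ (trans (cong proj₁ (sym (from-to single p)))
                             (cong (λ i → proj₁ (from single i)) (only (to single p))))
    where
    only : (i : Fin 1) → i ≡ zero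
    only zero = refl

pairing-four-distinct : (d : V 4 → ℕ) → d 𝟎 ≡ 0 → sumV d ≡ 4 → (∀ x → d x ≤ 1) → MultisetPairing 4 d
pairing-four-distinct d d0 sum simple =
  Pairing-relabel (Pairing-reindex (FourLabels.pairing-four w distinct-w nonzero) four)
                  (λ p → cong proj₁ (from-to four p))
  where
  four : Slots d ≅ Fin 4
  four = Slots≅Fin d ∘≅ Fin-cong sum
  w : Fin 4 → V 4
  w i = proj₁ (from four i)
  Fin≤1 : ∀ {m} → m ≤ 1 → (a b : Fin m) → a ≡ b
  Fin≤1 {suc zero} _ zero zero = refl
  Fin≤1 {suc (suc m)} (s≤s ()) _ _
  same-slot : ∀ {x y} (e : x ≡ y) (a : Fin (d x)) (b : Fin (d y)) → (x , a) ≡ (y , b)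
  same-slot {x} refl a b = cong (x ,_) (Fin≤1 (simple x) a b)
  distinct-w : ∀ i j → w i ≡ w j → i ≡ j
  distinct-w i j e = trans (sym (to-from four i))
    (trans (cong (to four) (same-slot e (proj₂ (from four i)) (proj₂ (from four j)))) (to-from four j))
  nonzero : ∀ i → ¬ (w i ≡ 𝟎)
  nonzero i = label≢𝟎 {d = d} d0 (Fin-pos (proj₂ (from four i)))

PairingClaim : ℕ → Set
PairingClaim k = (d : V (suc (suc k)) → ℕ) → Admissible k d → MultisetPairing (suc (suc k)) d

from-reduction : ∀ {j n} {d : V n → ℕ} → PairingClaim j → ReducesTo j d → MultisetPairing n d
from-reduction claim (d' , admissible , lift) = lift (claim d' admissible)

pairing-step : ∀ k → (∀ {j} → j < k → PairingClaim j) → PairingClaim k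
pairing-step zero _ d (d0 , sum , _) = pairing-base d d0 sum
pairing-step (suc k) claim d adm@(d0 , sum , supp) with argmax d
... | t , maximal with Counting.dichotomy d sum supp t maximal
...   | inj₁ few-odd = from-reduction (claim ≤-refl) (reduce-one d adm t M-pos few-odd)
  where open Counting d sum supp t maximal using (M-pos)
...   | inj₂ (_ , inj₁ (refl , M≡1)) = pairing-four-distinct d d0 sum (λ x → subst (d x ≤_) M≡1 (maximal x))
...   | inj₂ (M<q , inj₂ (refl , M≤4)) with Counting.second-label d sum supp t maximal M<q
...     | t₂ , p₂ , t₂≢t = from-reduction (claim (s≤s (s≤s (s≤s z≤n))))
                             (reduce-two d adm supp (λ x → ≤-trans (maximal x) M≤4) t t₂ M-pos p₂ t₂≢t)
  where open Counting d sum supp t maximal using (M-pos)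

multiset-pairing : ∀ k → PairingClaim k
multiset-pairing = <-rec PairingClaim pairing-step

multiplicity : ∀ {K n} → (Fin K → V n) → V n → ℕ
multiplicity {zero} ℓ x = 0
multiplicity {suc K} ℓ x = pt (ℓ zero) 1 x + multiplicity (λ t → ℓ (suc t)) x

point-slot : ∀ {n} (a : V n) → Fin 1 ≅ Slots (pt a 1)
point-slot a = Fin-cong (sym (sumV-pt a 1)) ∘≅ ≅-sym (Slots≅Fin (pt a 1))

indices≅slots : ∀ {K n} (ℓ : Fin K → V n) → Fin K ≅ Slots (multiplicity ℓ)
indices≅slots {zero} ℓ = record { to = λ () ; from = λ { (x , ()) } ; to-from = λ { (x , ()) } ; from-to = λ () }
indices≅slots {suc K} ℓ =
  Fin-+ 1 K ∘≅ ⊎-cong (point-slot (ℓ zero)) (indices≅slots (λ t → ℓ (suc t))) ∘≅ ≅-sym Σ-⊎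
  ∘≅ Σ-fib (λ x → ≅-sym (Fin-+ (pt (ℓ zero) 1 x) _))

slot-label : ∀ {K n} (ℓ : Fin K → V n) (t : Fin K) → proj₁ (to (indices≅slots ℓ) t) ≡ ℓ t
slot-label {suc K} ℓ zero = at-point _ (proj₂ (to (point-slot (ℓ zero)) zero))
  where
  at-point : ∀ x → Fin (pt (ℓ zero) 1 x) → x ≡ ℓ zero
  at-point x i with eqV x (ℓ zero) in e
  ... | true = eqV-sound x (ℓ zero) e
  at-point x () | false
slot-label {suc K} ℓ (suc t) = slot-label (λ t → ℓ (suc t)) t

sum-multiplicity : ∀ {K n} (ℓ : Fin K → V n) → sumV (multiplicity ℓ) ≡ K
sum-multiplicity ℓ = sym (Fin-inj (indices≅slots ℓ ∘≅ Slots≅Fin (multiplicity ℓ)))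

multiplicity-𝟎 : ∀ {K n} (ℓ : Fin K → V n) → (∀ t → ¬ (ℓ t ≡ 𝟎)) → multiplicity ℓ 𝟎 ≡ 0
multiplicity-𝟎 {zero} ℓ nz = refl
multiplicity-𝟎 {suc K} ℓ nz =
  cong₂ _+_ (cong (λ b → if b then 1 else 0) (eqV-false 𝟎 (ℓ zero) (λ e → nz zero (sym e))))
            (multiplicity-𝟎 (λ t → ℓ (suc t)) (λ t → nz (suc t)))

multiplicity-pos : ∀ {K n} (ℓ : Fin K → V n) x → 0 < multiplicity ℓ x → ∃[ t ] ℓ t ≡ x
multiplicity-pos {suc K} ℓ x p with eqV x (ℓ zero) in e
... | true = zero , sym (eqV-sound x (ℓ zero) e)
... | false = let (t , q) = multiplicity-pos (λ t → ℓ (suc t)) x p in suc t , q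

memV : ∀ {n} → V n → List (V n) → Bool
memV x [] = false
memV x (a ∷ ws) = if eqV x a then true else memV x ws

memV-complete : ∀ {n} (x : V n) ws → x ∈ ws → memV x ws ≡ true
memV-complete x (a ∷ ws) (here refl) rewrite eqV-refl x = refl
memV-complete x (a ∷ ws) (there m) with eqV x a
... | true = refl
... | false = memV-complete x ws m

indicator : ∀ {n} → List (V n) → V n → ℕ
indicator ws x = if memV x ws then 1 else 0

sum-indicator : ∀ {n} (ws : List (V n)) → sumV (indicator ws) ≤ length ws
sum-indicator {n} [] = ≤-reflexive (sumV-0 {n})
sum-indicator (a ∷ ws) = begin
  sumV (indicator (a ∷ ws))             ≤⟨ sumV-≤ pointwise ⟩
  sumV (λ x → pt a 1 x + indicator ws x) ≡⟨ sumV-+ (pt a 1) (indicator ws) ⟩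
  sumV (pt a 1) + sumV (indicator ws)    ≡⟨ cong (_+ sumV (indicator ws)) (sumV-pt a 1) ⟩
  suc (sumV (indicator ws))             ≤⟨ s≤s (sum-indicator ws) ⟩
  suc (length ws)                       ∎
  where
  open ≤-Reasoning
  pointwise : ∀ x → indicator (a ∷ ws) x ≤ pt a 1 x + indicator ws x
  pointwise x with eqV x a
  ... | true = s≤s z≤n
  ... | false = ≤-refl

support-multiplicity : ∀ {K n} (ℓ : Fin K → V n) (ws : List (V n)) → (∀ t → ℓ t ∈ ws) →
                       support (multiplicity ℓ) ≤ length ws
support-multiplicity ℓ ws in-ws = ≤-trans (sumV-≤ pointwise) (sum-indicator ws)
  where
  pointwise : ∀ x → pos (multiplicity ℓ x) ≤ indicator ws x
  pointwise x with multiplicity ℓ x in e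
  ... | zero = z≤n
  ... | suc _ with multiplicity-pos ℓ x (subst (0 <_) (sym e) (s≤s z≤n))
  ...   | (t , ℓt≡x) rewrite memV-complete x ws (subst (_∈ ws) ℓt≡x (in-ws t)) = ≤-refl

-- Indices i < 2^(m+1) as pairs (⌊i/2⌋ , i mod 2).
bit : Bool → Fin 2
bit false = zero
bit true = suc zero

pair-index : ∀ m → Fin (2 ^ suc m) ≅ (Fin (2 ^ m) × Bool)
pair-index m = Fin-cong (*-comm 2 (2 ^ m)) ∘≅ quotient-remainder ∘≅ ×-cong ≅-refl Fin2≅Bool
  where
  quotient-remainder : Fin (2 ^ m * 2) ≅ (Fin (2 ^ m) × Fin 2)
  quotient-remainder = record { to = remQuot 2 ; from = uncurry combine
                              ; to-from = λ { (i , j) → remQuot-combine i j } ; from-to = combine-remQuot {2 ^ m} 2 }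
  Fin2≅Bool : Fin 2 ≅ Bool
  Fin2≅Bool = record
    { to = λ { zero → false ; (suc zero) → true } ; from = bit
    ; to-from = λ { false → refl ; true → refl } ; from-to = λ { zero → refl ; (suc zero) → refl } }

pair-index-/2 : ∀ m t b → toℕ (from (pair-index m) (t , b)) / 2 ≡ toℕ t
pair-index-/2 m t b = trans (cong (_/ 2) (trans (toℕ-cast (*-comm 2 (2 ^ m)) (combine t (bit b)))
                                               (toℕ-combine t (bit b))))
                            (half (toℕ t) (toℕ (bit b)) (toℕ<n (bit b)))
  where
  toℕ-cast : ∀ {a c} (e : a ≡ c) (i : Fin c) → toℕ (from (Fin-cong e) i) ≡ toℕ i
  toℕ-cast refl i = refl
  half : ∀ s r → r < 2 → (2 * s + r) / 2 ≡ s
  half s r r<2 = trans (+-distrib-/ (2 * s) r no-carry) (trans (cong₂ _+_ double/2 (m<n⇒m/n≡0 r<2)) (+-identityʳ s))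
    where
    double%2 : (2 * s) % 2 ≡ 0
    double%2 = trans (cong (_% 2) (*-comm 2 s)) (m*n%n≡0 s 2)
    no-carry : (2 * s) % 2 + r % 2 < 2
    no-carry = subst₂ (λ x y → x + y < 2) (sym double%2) (sym (m<n⇒m%n≡m r<2)) r<2
    double/2 : (2 * s) / 2 ≡ s
    double/2 = trans (cong (_/ 2) (*-comm 2 s)) (m*n/n≡m s 2)

≅⇒bijective : ∀ {A B : Set} (e : A ≅ B) (f : A → B) → (∀ a → f a ≡ to e a) → Bijective _≡_ _≡_ f
≅⇒bijective e f f≡ = injective , surjective
  where
  injective : ∀ {x y} → f x ≡ f y → x ≡ y
  injective {x} {y} h = trans (sym (from-to e x))
    (trans (cong (from e) (trans (sym (f≡ x)) (trans h (f≡ y)))) (from-to e y))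
  surjective : ∀ y → ∃ λ x → ∀ {z} → z ≡ x → f z ≡ y
  surjective y = from e y , λ { refl → trans (f≡ (from e y)) (to-from e y) }

-- Lemma 10.  Index the labels by pairs (t , b) of the 2^m pairs of equal labels; their
-- multiset is admissible (nonzero labels, 2^m of them, at most m + 2 distinct), so it has
-- a pairing; enumerating its pairs by the original indices gives p and q.
lemma10 : (m : ℕ) (v : Fin (2 ^ suc m) → F₂^ (suc (suc m)))
          → (∀ i → ¬ (v i ≡ 𝟎))
          → (∀ i j → toℕ i / 2 ≡ toℕ j / 2 → v i ≡ v j)
          → (∃[ ws ] (length ws ≡ suc (suc m) × Unique ws
                      × (∀ i → v i ∈ ws) × (∀ w → w ∈ ws → ∃[ i ] v i ≡ w)))
          → Σ[ p ∈ (Fin (2 ^ suc m) → F₂^ (suc (suc m))) ]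
            Σ[ q ∈ (Fin (2 ^ suc m) → F₂^ (suc (suc m))) ]
              ((∀ i → p i ⊕ q i ≡ v i)
              × Bijective _≡_ _≡_ (λ (ib : Fin (2 ^ suc m) × Bool) →
                  if proj₂ ib then q (proj₁ ib) else p (proj₁ ib)))
lemma10 m v nonzero paired (ws , length-ws , _ , in-ws , _) =
  p , q , p⊕q , ≅⇒bijective enumeration _ (λ { (i , false) → refl ; (i , true) → refl })
  where
  index = pair-index m
  ℓ : Fin (2 ^ m) → V (suc (suc m))
  ℓ t = v (from index (t , false))
  v≡ℓ : ∀ i → v i ≡ ℓ (proj₁ (to index i))
  v≡ℓ i = paired i (from index (proj₁ (to index i) , false))
    (trans (cong (λ z → toℕ z / 2) (sym (from-to index i)))
      (trans (pair-index-/2 m (proj₁ (to index i)) (proj₂ (to index i)))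
             (sym (pair-index-/2 m (proj₁ (to index i)) false))))
  admissible : Admissible m (multiplicity ℓ)
  admissible = multiplicity-𝟎 ℓ (λ t → nonzero _) , sum-multiplicity ℓ ,
               subst (support (multiplicity ℓ) ≤_) length-ws (support-multiplicity ℓ ws (λ t → in-ws _))
  pairing : Pairing (suc (suc m)) (Fin (2 ^ m)) ℓ
  pairing = Pairing-relabel (Pairing-reindex (multiset-pairing m (multiplicity ℓ) admissible) (indices≅slots ℓ))
                            (slot-label ℓ)
  enumeration : (Fin (2 ^ suc m) × Bool) ≅ V (suc (suc m))
  enumeration = ×-cong index ≅-refl ∘≅ ×-assoc ∘≅ proj₁ pairing
  p q : Fin (2 ^ suc m) → V (suc (suc m))
  p i = to enumeration (i , false)
  q i = to enumeration (i , true)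
  p⊕q : ∀ i → p i ⊕ q i ≡ v i
  p⊕q i = begin
    p i ⊕ q i                 ≡⟨ cong (p i ⊕_) (proj₂ pairing (proj₁ (to index i)) (proj₂ (to index i))) ⟩
    p i ⊕ (p i ⊕ ℓ t)         ≡⟨ sym (⊕-assoc (p i) (p i) (ℓ t)) ⟩
    (p i ⊕ p i) ⊕ ℓ t         ≡⟨ cong (_⊕ ℓ t) (⊕-self (p i)) ⟩
    𝟎 ⊕ ℓ t                   ≡⟨ ⊕-idˡ (ℓ t) ⟩
    ℓ t                       ≡⟨ sym (v≡ℓ i) ⟩
    v i                       ∎
    where
    open ≡-Reasoning
    t = proj₁ (to index i)
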